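{- Let $M=(V,D)$ be a normal vf-closed $\Delta$-matroid and $u\in V$. (1) If $X\in M$ with $u\in X$, then $q_1(M)=q_1(M\setminus u)+q_1(M*X\setminus u)$. (2) If $v\in V$ is such that $\{u,v\}\in M$ and $\{u\}\notin M$, $\{v\}\notin M$, then \[q_2(M)=q_2(M*\{u,v\}\setminus\{u,v\})+q_2(M*\{u\}\,\bar{*}\,\{v\}\setminus\{u,v\})+q_2(M\,\bar{*}\,\{u\}\setminus u).\] (3) If $Y\in M+V$ with $u\in Y$, then $q_3(M)=q_3(M\,\bar{*}\,Y\setminus u)+q_3(M\setminus u)$. Moreover, each of the set systems on the right-hand sides above (the "components") is normal.
   Context: A set system is $M=(V,D)$ with $V$ finite, $D$ a family of subsets of $V$; write $Z\in M$ for $Z\in D$; proper means $D\neq\emptyset$; normal means $\emptyset\in D$. $\oplus$ is symmetric difference. Pivot: $M*X=(V,\{Z\oplus X:Z\in D\})$; loop complementation: $M+w=(V,D\oplus\{Z\cup\{w\}:Z\in D,w\notin Z\})$; operations are applied left to right; dual pivot $M\,\bar{*}\,w=M+w*w+w$; operations on distinct elements commute, and $M+X$, $M\,\bar{*}\,X$ denote applying the operation for every element of $X$. For $X\subseteq V$, $M\setminus X=(V\setminus X,\{Z\in D:Z\cap X=\emptyset\})$, and $M\setminus u=M\setminus\{u\}$. For proper $M$, $d_M(X)=\min\{|X\oplus Z|:Z\in M\}$, $d_M=d_M(\emptyset)$; $q_1(M)=\sum_{X\subseteq V}y^{d_{M*X}}$, $q_2(M)=q_1(M\,\bar{*}\,V)$,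 $q_3(M)=q_1(M+V)$. A $\Delta$-matroid is a proper set system such that for all $X,Y\in M$ and $w\in X\oplus Y$, either $X\oplus\{w\}\in M$ or some $v\in X\oplus Y$, $v\neq w$, has $X\oplus\{w,v\}\in M$. $M$ is a vf-closed $\Delta$-matroid if $M\varphi$ is a $\Delta$-matroid for every (possibly empty) sequence $\varphi$ of pivots and loop complementations on elements of $V$. -}

module Defs where

open import Data.Nat using (ℕ; zero; suc; _⊓_)
open import Data.Bool using (Bool; true; false; _∧_; _xor_; not; if_then_else_)
open import Data.Fin using (Fin)
open import Data.Fin.Subset using (Subset; _∈_; _⊆_; _∪_; _∩_; _─_; ⁅_⁆; ∣_∣; ⊥; ⊤)
open import Data.Fin.Subset.Properties using (_⊆?_)
open import Data.Vec using (Vec; []; _∷_; zipWith; lookup; foldr)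
open import Data.List using (List; []; _∷_; _++_; map; filter; length)
import Data.List as L
open import Data.List.Relation.Unary.All using (All)
open import Data.Product using (Σ; ∃; _×_; _,_)
open import Data.Sum using (_⊎_)
open import Relation.Binary.PropositionalEquality using (_≡_; _≢_)
open import Relation.Nullary.Decidable using (_×-dec_)
import Data.Nat as N

-- Ground sets are subsets V of the universe Fin n.
-- A set system M = (V , D): the family D is given by its (decidable)
-- characteristic function on subsets of Fin n.
record SetSystem (n : ℕ) : Set where
  constructor ⟨_,_⟩
  field
    ground : Subset n
    fam    : Subset n → Bool
open SetSystem public

_∈M_ : ∀ {n} → Subset n → SetSystem n → Set
Z ∈M M = fam M Z ≡ true

WellFormed : ∀ {n} → SetSystem n → Set
WellFormed M = ∀ Z → Z ∈M M → Z ⊆ ground M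

Proper : ∀ {n} → SetSystem n → Set
Proper M = ∃ λ Z → Z ∈M M

Normal : ∀ {n} → SetSystem n → Set
Normal M = ⊥ ∈M M

_⊕_ : ∀ {n} → Subset n → Subset n → Subset n
_⊕_ = zipWith _xor_

isEmpty : ∀ {n} → Subset n → Bool
isEmpty = foldr _ (λ b acc → not b ∧ acc) true

_*_ : ∀ {n} → SetSystem n → Subset n → SetSystem n
M * X = ⟨ ground M , (λ Z → fam M (Z ⊕ X)) ⟩

-- loop complementation  M + w  :  D ⊕ { Z ∪ {w} : Z ∈ D , w ∉ Z }
_+w_ : ∀ {n} → SetSystem n → Fin n → SetSystem n
M +w w = ⟨ ground M , (λ Z → fam M Z xor (lookup Z w ∧ fam M (Z ─ ⁅ w ⁆))) ⟩

_*w_ : ∀ {n} → SetSystem n → Fin n → SetSystem n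
M *w w = M * ⁅ w ⁆

_*̄w_ : ∀ {n} → SetSystem n → Fin n → SetSystem n
M *̄w w = ((M +w w) *w w) +w w

elems : (n : ℕ) → List (Fin n)
elems n = L.allFin n

-- apply a single-element operation for every element of X
-- (these operations commute on distinct elements, so the order is immaterial)
forEach : ∀ {n} → (SetSystem n → Fin n → SetSystem n) → SetSystem n → Subset n → SetSystem n
forEach op M X = L.foldr (λ i acc → if lookup X i then op acc i else acc) M (elems _)

_+_ : ∀ {n} → SetSystem n → Subset n → SetSystem n
M + X = forEach _+w_ M X

_*̄_ : ∀ {n} → SetSystem n → Subset n → SetSystem n
M *̄ X = forEach _*̄w_ M X

_∖_ : ∀ {n} → SetSystem n → Subset n → SetSystem n
M ∖ X = ⟨ ground M ─ X , (λ Z → fam M Z ∧ isEmpty (Z ∩ X)) ⟩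

_∖w_ : ∀ {n} → SetSystem n → Fin n → SetSystem n
M ∖w u = M ∖ ⁅ u ⁆

subsets : (n : ℕ) → List (Subset n)
subsets zero = [] ∷ []
subsets (suc n) = map (true ∷_) (subsets n) ++ map (false ∷_) (subsets n)

-- d_M(X) = min { |X ⊕ Z| : Z ∈ M }  (for proper M; |X ⊕ Z| ≤ n so the
-- initial value n of the fold does not affect the minimum)
dist : ∀ {n} → SetSystem n → Subset n → ℕ
dist {n} M X = L.foldr (λ Z acc → if fam M Z then ∣ X ⊕ Z ∣ ⊓ acc else acc) n (subsets n)

d : ∀ {n} → SetSystem n → ℕ
d M = dist M ⊥

-- Polynomials in y with natural coefficients, as coefficient sequences.
Poly : Set
Poly = ℕ → ℕ

_⊞_ : Poly → Poly → Poly
(p ⊞ q) k = p k N.+ q k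

-- q₁(M) = Σ_{X ⊆ V} y^{d_{M*X}} : coefficient of y^k is the number of
-- X ⊆ V with d_{M*X} = k
q₁ : ∀ {n} → SetSystem n → Poly
q₁ {n} M k = length (filter (λ X → (X ⊆? ground M) ×-dec (d (M * X) N.≟ k)) (subsets n))

q₂ : ∀ {n} → SetSystem n → Poly
q₂ M = q₁ (M *̄ ground M)

q₃ : ∀ {n} → SetSystem n → Poly
q₃ M = q₁ (M + ground M)

IsΔMatroid : ∀ {n} → SetSystem n → Set
IsΔMatroid M =
  Proper M ×
  (∀ X Y → X ∈M M → Y ∈M M → ∀ w → w ∈ (X ⊕ Y) →
     ((X ⊕ ⁅ w ⁆) ∈M M) ⊎
     (∃ λ v → v ∈ (X ⊕ Y) × v ≢ w × ((X ⊕ (⁅ w ⁆ ∪ ⁅ v ⁆)) ∈M M)))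

data Op (n : ℕ) : Set where
  piv  : Fin n → Op n
  loop : Fin n → Op n

opElem : ∀ {n} → Op n → Fin n
opElem (piv w) = w
opElem (loop w) = w

applyOp : ∀ {n} → SetSystem n → Op n → SetSystem n
applyOp M (piv w) = M *w w
applyOp M (loop w) = M +w w

applySeq : ∀ {n} → SetSystem n → List (Op n) → SetSystem n
applySeq M [] = M
applySeq M (o ∷ φ) = applySeq (applyOp M o) φ

VfClosed : ∀ {n} → SetSystem n → Set
VfClosed M = ∀ (φ : List (Op _)) → All (λ o → opElem o ∈ ground M) φ → IsΔMatroid (applySeq M φ)

-- Each operation on set systems acts on the indicator function of the family, viewed as a vector over GF(2)
-- indexed by subsets, as a tensor product of 2×2 matrices, one per element: pivoting on w swaps the values at
-- Z − w and Z + w, deleting w kills the values at sets containing w, and so on.  Composites of operations multiply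
-- coordinatewise, so every identification between the set systems occurring in the recurrences reduces to a
-- finite check of 2×2 matrix identities at each kind of coordinate.
--
-- All three recurrences come from one splitting lemma: if N satisfies the exchange axiom and has members P ∌ u
-- and Q ∋ u, then q₁(N) = q₁(N \ u) + q₁(N * S \ u) for every S ⊆ V containing u.  Split the sets X ⊆ V by
-- whether u ∈ X and translate the second class by S; what remains is that each d_{N*X} is attained by a set
-- avoiding u, which is the exchange axiom at u applied to a minimiser and to P ⊕ X (respectively Q ⊕ S ⊕ X).
-- Part (1) is the lemma for N = M and part (3) for N = M + V.  Part (2) applies it to N = M *̄ V at u with S = {u},
-- and then to the second summand at v with S = {v}; the members P and Q needed there exist because certain
-- transfers of M, evaluated at ∅ by the matrix calculus, equal M(∅) + M({u}) or M({u}) + M({u,v}) or M({u,v}).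

module Submission where

open import Defs
open import Data.Nat using (ℕ; zero; suc; _≤_; s≤s; _⊓_; _≟_)
import Data.Nat as ℕ
open import Data.Nat.Properties
  using (≤-refl; ≤-trans; ≤-reflexive; ≤-antisym; n≤1+n; +-comm; +-assoc; +-suc; m⊓n≤m; m⊓n≤n; ⊓-sel)
open import Data.Bool using (Bool; true; false; _∧_; _∨_; _xor_; not; if_then_else_)
open import Data.Bool.Properties
  using (xor-∧-commutativeRing; xor-assoc; xor-comm; xor-identityʳ; xor-same; ∧-identityʳ; ∧-zeroʳ;
         ∨-zeroʳ; ∨-identityʳ; ∧-conicalˡ; ∧-conicalʳ; ¬-not; not-¬; not-involutive)
open import Data.Fin using (Fin; zero; suc)
open import Data.Fin.Subset using (Subset; _∈_; _⊆_; _∪_; _∩_; _─_; ⁅_⁆; ∣_∣; ⊥)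
open import Data.Fin.Subset.Properties
  using (_⊆?_; ⊆-refl; drop-∷-⊆; ∣p∣≤n; x∈⁅x⁆; x∈⁅y⁆⇒x≡y; x∈p∧x≢y⇒x∈p-y; ∪-idem; ∪-identityˡ; p─q─r≡p─q∪r)
open import Data.Vec using ([]; _∷_; lookup; _[_]≔_)
open import Data.Vec.Properties
  using (lookup-zipWith; lookup-replicate; tabulate∘lookup; tabulate-cong; zipWith-assoc; zipWith-comm;
         zipWith-identityʳ; lookup⇒[]=; []=⇒lookup; []≔-lookup)
open import Data.List using (List; []; _∷_; _++_; map; filter; length)
import Data.List as List
open import Data.List.Membership.Propositional using () renaming (_∈_ to _∈ₗ_)
open import Data.List.Membership.Propositional.Properties using (∈-++⁺ˡ; ∈-++⁺ʳ; ∈-map⁺)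
open import Data.List.Relation.Unary.Any using (here; there)
open import Data.List.Relation.Unary.All using (All; []; _∷_)
open import Data.List.Relation.Unary.All.Properties using (++⁺)
open import Data.Maybe using (just; nothing)
open import Data.Product using (∃; _×_; _,_; proj₁; proj₂)
open import Data.Sum using (_⊎_; inj₁; inj₂)
open import Data.Empty using (⊥-elim) renaming (⊥ to Empty)
open import Function using (_∘_; id)
open import Level using (0ℓ)
open import Relation.Nullary using (¬_; does)
open import Relation.Nullary.Decidable using (_×-dec_)
open import Relation.Unary using (Pred; Decidable)
open import Relation.Binary.PropositionalEquality
open import Tactic.RingSolver.Core.AlmostCommutativeRing using (AlmostCommutativeRing; fromCommutativeRing)
open import Tactic.RingSolver using (solve-∀)

private
  variable
    n : ℕ

-- Subsets as Boolean vectors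

Subset-ext : {X Y : Subset n} → (∀ i → lookup X i ≡ lookup Y i) → X ≡ Y
Subset-ext {X = X} {Y} h = trans (sym (tabulate∘lookup X)) (trans (tabulate-cong h) (tabulate∘lookup Y))

lookup-⊕ : ∀ (X Y : Subset n) i → lookup (X ⊕ Y) i ≡ lookup X i xor lookup Y i
lookup-⊕ X Y i = lookup-zipWith _xor_ i X Y

lookup-∪ : ∀ (X Y : Subset n) i → lookup (X ∪ Y) i ≡ lookup X i ∨ lookup Y i
lookup-∪ X Y i = lookup-zipWith _∨_ i X Y

lookup-─ : ∀ (X Y : Subset n) i → lookup (X ─ Y) i ≡ (if lookup Y i then false else lookup X i)
lookup-─ (x ∷ X) (true  ∷ Y) zero    = refl
lookup-─ (x ∷ X) (false ∷ Y) zero    = refl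
lookup-─ (x ∷ X) (y ∷ Y)     (suc i) = lookup-─ X Y i

lookup-⊥ : ∀ (i : Fin n) → lookup ⊥ i ≡ false
lookup-⊥ i = lookup-replicate i false

lookup-⁅⁆-self : ∀ (i : Fin n) → lookup ⁅ i ⁆ i ≡ true
lookup-⁅⁆-self i = []=⇒lookup (x∈⁅x⁆ i)

lookup-⁅⁆⇒≡ : ∀ (u i : Fin n) → lookup ⁅ u ⁆ i ≡ true → i ≡ u
lookup-⁅⁆⇒≡ u i p = x∈⁅y⁆⇒x≡y u (lookup⇒[]= i ⁅ u ⁆ p)

lookup-⁅⁆-≢ : ∀ (u i : Fin n) → i ≢ u → lookup ⁅ u ⁆ i ≡ false
lookup-⁅⁆-≢ u i i≢u = ¬-not (i≢u ∘ lookup-⁅⁆⇒≡ u i)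

⊆⇒lookup : ∀ {X V : Subset n} → X ⊆ V → ∀ i → lookup X i ≡ true → lookup V i ≡ true
⊆⇒lookup {X = X} X⊆V i p = []=⇒lookup (X⊆V (lookup⇒[]= i X p))

⁅⁆⊆ : ∀ {u : Fin n} {V} → u ∈ V → ⁅ u ⁆ ⊆ V
⁅⁆⊆ u∈V x∈⁅u⁆ rewrite x∈⁅y⁆⇒x≡y _ x∈⁅u⁆ = u∈V

⊕-assoc : ∀ (X Y Z : Subset n) → (X ⊕ Y) ⊕ Z ≡ X ⊕ (Y ⊕ Z)
⊕-assoc = zipWith-assoc xor-assoc

⊕-comm : ∀ (X Y : Subset n) → X ⊕ Y ≡ Y ⊕ X
⊕-comm = zipWith-comm xor-comm

⊕-identityʳ : ∀ (X : Subset n) → X ⊕ ⊥ ≡ X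
⊕-identityʳ = zipWith-identityʳ xor-identityʳ

⊕-identityˡ : ∀ (X : Subset n) → ⊥ ⊕ X ≡ X
⊕-identityˡ []      = refl
⊕-identityˡ (x ∷ X) = cong (x ∷_) (⊕-identityˡ X)

⊕-self : ∀ (X : Subset n) → X ⊕ X ≡ ⊥
⊕-self X = Subset-ext λ i → trans (lookup-⊕ X X i) (trans (xor-same (lookup X i)) (sym (lookup-⊥ i)))

⊕-cancelʳ : ∀ (X Y : Subset n) → (X ⊕ Y) ⊕ Y ≡ X
⊕-cancelʳ X Y = trans (⊕-assoc X Y Y) (trans (cong (X ⊕_) (⊕-self Y)) (⊕-identityʳ X))

⊕-swap : ∀ (X Y Z : Subset n) → (X ⊕ Y) ⊕ Z ≡ (X ⊕ Z) ⊕ Y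
⊕-swap X Y Z = trans (⊕-assoc X Y Z) (trans (cong (X ⊕_) (⊕-comm Y Z)) (sym (⊕-assoc X Z Y)))

⁅⁆∪⁅⁆≡⁅⁆⊕⁅⁆ : ∀ (u v : Fin n) → u ≢ v → ⁅ u ⁆ ∪ ⁅ v ⁆ ≡ ⁅ u ⁆ ⊕ ⁅ v ⁆
⁅⁆∪⁅⁆≡⁅⁆⊕⁅⁆ u v u≢v = Subset-ext λ i →
  trans (lookup-∪ ⁅ u ⁆ ⁅ v ⁆ i)
    (trans (disjoint (λ p q → u≢v (trans (sym (lookup-⁅⁆⇒≡ u i p)) (lookup-⁅⁆⇒≡ v i q))))
      (sym (lookup-⊕ ⁅ u ⁆ ⁅ v ⁆ i)))
  where
  disjoint : ∀ {a b} → (a ≡ true → b ≡ true → Empty) → a ∨ b ≡ a xor b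
  disjoint {true}  {true}  h = ⊥-elim (h refl refl)
  disjoint {true}  {false} h = refl
  disjoint {false} {b}     h = refl

lookup-[]≔ : ∀ (Z : Subset n) w b i → lookup (Z [ w ]≔ b) i ≡ (if lookup ⁅ w ⁆ i then b else lookup Z i)
lookup-[]≔ (z ∷ Z) zero    b zero    = refl
lookup-[]≔ (z ∷ Z) zero    b (suc i) rewrite lookup-⊥ i = refl
lookup-[]≔ (z ∷ Z) (suc w) b zero    = refl
lookup-[]≔ (z ∷ Z) (suc w) b (suc i) = lookup-[]≔ Z w b i

[]≔false : ∀ (Z : Subset n) w → Z [ w ]≔ false ≡ Z ─ ⁅ w ⁆
[]≔false Z w = Subset-ext λ i → trans (lookup-[]≔ Z w false i) (sym (lookup-─ Z ⁅ w ⁆ i))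

[]≔true : ∀ (Z : Subset n) w → Z [ w ]≔ true ≡ Z ∪ ⁅ w ⁆
[]≔true Z w = Subset-ext λ i → trans (lookup-[]≔ Z w true i) (trans (by-cases (lookup ⁅ w ⁆ i)) (sym (lookup-∪ Z ⁅ w ⁆ i)))
  where
  by-cases : ∀ {z} b → (if b then true else z) ≡ z ∨ b
  by-cases true  = sym (∨-zeroʳ _)
  by-cases false = sym (∨-identityʳ _)

isEmpty-∩⁅⁆ : ∀ (W : Subset n) u → isEmpty (W ∩ ⁅ u ⁆) ≡ not (lookup W u)
isEmpty-∩⁅⁆ (w ∷ W) zero = trans (cong (not (w ∧ true) ∧_) (isEmpty-∩⊥ W)) (trans (∧-identityʳ _) (cong not (∧-identityʳ w)))
  where
  isEmpty-∩⊥ : ∀ {m} (W : Subset m) → isEmpty (W ∩ ⊥) ≡ true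
  isEmpty-∩⊥ []      = refl
  isEmpty-∩⊥ (w ∷ W) rewrite ∧-zeroʳ w = isEmpty-∩⊥ W
isEmpty-∩⁅⁆ (w ∷ W) (suc u) rewrite ∧-zeroʳ w = isEmpty-∩⁅⁆ W u

isEmpty-⊥∩ : ∀ (S : Subset n) → isEmpty (⊥ ∩ S) ≡ true
isEmpty-⊥∩ []      = refl
isEmpty-⊥∩ (s ∷ S) = isEmpty-⊥∩ S

∣⊕⁅⁆∣-remove : ∀ (Z : Subset n) u → lookup Z u ≡ true → suc ∣ Z ⊕ ⁅ u ⁆ ∣ ≡ ∣ Z ∣
∣⊕⁅⁆∣-remove (true  ∷ Z) zero    p = cong (suc ∘ ∣_∣) (⊕-identityʳ Z)
∣⊕⁅⁆∣-remove (true  ∷ Z) (suc u) p = cong suc (∣⊕⁅⁆∣-remove Z u p)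
∣⊕⁅⁆∣-remove (false ∷ Z) (suc u) p = ∣⊕⁅⁆∣-remove Z u p

∣⊕⁅⁆∣≤ : ∀ (Z : Subset n) u → ∣ Z ⊕ ⁅ u ⁆ ∣ ≤ suc ∣ Z ∣
∣⊕⁅⁆∣≤ (true  ∷ Z) zero    rewrite ⊕-identityʳ Z = ≤-trans (n≤1+n _) (n≤1+n _)
∣⊕⁅⁆∣≤ (false ∷ Z) zero    rewrite ⊕-identityʳ Z = ≤-refl
∣⊕⁅⁆∣≤ (true  ∷ Z) (suc u) = s≤s (∣⊕⁅⁆∣≤ Z u)
∣⊕⁅⁆∣≤ (false ∷ Z) (suc u) = ∣⊕⁅⁆∣≤ Z u

∣⊕⁅⁆∣-≤-∈ : ∀ (Z : Subset n) u → lookup Z u ≡ true → ∣ Z ⊕ ⁅ u ⁆ ∣ ≤ ∣ Z ∣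
∣⊕⁅⁆∣-≤-∈ Z u p = ≤-trans (n≤1+n _) (≤-reflexive (∣⊕⁅⁆∣-remove Z u p))

∣⊕⁅⁆∪⁅⁆∣-≤-∈ : ∀ (Z : Subset n) u v → lookup Z u ≡ true → v ≢ u → ∣ Z ⊕ (⁅ u ⁆ ∪ ⁅ v ⁆) ∣ ≤ ∣ Z ∣
∣⊕⁅⁆∪⁅⁆∣-≤-∈ Z u v p v≢u rewrite ⁅⁆∪⁅⁆≡⁅⁆⊕⁅⁆ u v (v≢u ∘ sym) | sym (⊕-assoc Z ⁅ u ⁆ ⁅ v ⁆) =
  ≤-trans (∣⊕⁅⁆∣≤ (Z ⊕ ⁅ u ⁆) v) (≤-reflexive (∣⊕⁅⁆∣-remove Z u p))

-- Transfer matrices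

BoolRing : AlmostCommutativeRing 0ℓ 0ℓ
BoolRing = fromCommutativeRing xor-∧-commutativeRing λ { false → just refl ; true → nothing }

record Mat : Set where
  constructor mat
  field
    m₀₀ m₀₁ m₁₀ m₁₁ : Bool

apply : Mat → Bool → Bool → Bool → Bool
apply (mat a b c e) false x y = (a ∧ x) xor (b ∧ y)
apply (mat a b c e) true  x y = (c ∧ x) xor (e ∧ y)

infixl 7 _·_
_·_ : Mat → Mat → Mat
mat a b c e · mat a' b' c' e' =
  mat ((a ∧ a') xor (b ∧ c')) ((a ∧ b') xor (b ∧ e')) ((c ∧ a') xor (e ∧ c')) ((c ∧ b') xor (e ∧ e'))

idM pivotM deleteM loopM dualM : Mat
idM     = mat true  false false true
pivotM  = mat false true  true  false
deleteM = mat true  false false false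
loopM   = mat true  false true  true
dualM   = mat true  true  false true

private
  row-linear : ∀ r s α β x y x' y' →
    (r ∧ ((α ∧ x) xor (β ∧ y))) xor (s ∧ ((α ∧ x') xor (β ∧ y')))
      ≡ (α ∧ ((r ∧ x) xor (s ∧ x'))) xor (β ∧ ((r ∧ y) xor (s ∧ y')))
  row-linear = solve-∀ BoolRing

  row-product : ∀ r s a b c e x y →
    (((r ∧ a) xor (s ∧ c)) ∧ x) xor (((r ∧ b) xor (s ∧ e)) ∧ y)
      ≡ (r ∧ ((a ∧ x) xor (b ∧ y))) xor (s ∧ ((c ∧ x) xor (e ∧ y)))
  row-product = solve-∀ BoolRing

apply-linear : ∀ m z α β x y x' y' →
  apply m z ((α ∧ x) xor (β ∧ y)) ((α ∧ x') xor (β ∧ y')) ≡ (α ∧ apply m z x x') xor (β ∧ apply m z y y')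
apply-linear (mat a b c e) false = row-linear a b
apply-linear (mat a b c e) true  = row-linear c e

apply-· : ∀ A B z x y → apply (A · B) z x y ≡ apply A z (apply B false x y) (apply B true x y)
apply-· (mat a b c e) (mat a' b' c' e') false = row-product a b a' b' c' e'
apply-· (mat a b c e) (mat a' b' c' e') true  = row-product c e a' b' c' e'

apply-true : ∀ m z x y → apply m z x y ≡ true → x ≡ true ⊎ y ≡ true
apply-true m z true  y h = inj₁ refl
apply-true m z false true  h = inj₂ refl
apply-true (mat a b c e) false false false h rewrite ∧-zeroʳ a | ∧-zeroʳ b with h
... | ()
apply-true (mat a b c e) true false false h rewrite ∧-zeroʳ c | ∧-zeroʳ e with h
... | ()

Fam : ℕ → Set
Fam n = Subset n → Bool

-- act A f is (⊗ᵢ A i) f: at a set Z the factor A i contributes its row [i ∈ Z], applied to the column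
-- (value at Z − i , value at Z + i).
act : (Fin n → Mat) → Fam n → Fam n
act {zero}  A f Z       = f Z
act {suc n} A f (z ∷ Z) = apply (A zero) z (act (A ∘ suc) (f ∘ (false ∷_)) Z) (act (A ∘ suc) (f ∘ (true ∷_)) Z)

_⊙_ : (Fin n → Mat) → (Fin n → Mat) → Fin n → Mat
(A ⊙ B) i = A i · B i

when : Bool → Mat → Mat
when b m = if b then m else idM

onSet : Subset n → Mat → Fin n → Mat
onSet S m i = when (lookup S i) m

act-cong : ∀ {A B : Fin n → Mat} {f g : Fam n} → (∀ i → A i ≡ B i) → f ≗ g → act A f ≗ act B g
act-cong {zero}  hA hf Z = hf Z
act-cong {suc n} hA hf (z ∷ Z) rewrite hA zero =
  cong₂ (apply _ z) (act-cong (hA ∘ suc) (hf ∘ (false ∷_)) Z) (act-cong (hA ∘ suc) (hf ∘ (true ∷_)) Z)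

act-id : ∀ {A : Fin n → Mat} {f : Fam n} → (∀ i → A i ≡ idM) → act A f ≗ f
act-id {zero}  h Z = refl
act-id {suc n} {A} {f} h (z ∷ Z) rewrite h zero with z
... | false = trans (xor-identityʳ _) (act-id (h ∘ suc) Z)
... | true  = act-id (h ∘ suc) Z

act-linear : ∀ (A : Fin n → Mat) (f g : Fam n) α β Z →
  act A (λ W → (α ∧ f W) xor (β ∧ g W)) Z ≡ (α ∧ act A f Z) xor (β ∧ act A g Z)
act-linear {zero}  A f g α β Z = refl
act-linear {suc n} A f g α β (z ∷ Z) =
  trans (cong₂ (apply (A zero) z) (act-linear (A ∘ suc) _ _ α β Z) (act-linear (A ∘ suc) _ _ α β Z))
    (apply-linear (A zero) z α β _ _ _ _)

act-∘ : ∀ (A B : Fin n → Mat) (f : Fam n) → act A (act B f) ≗ act (A ⊙ B) f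
act-∘ {zero}  A B f Z = refl
act-∘ {suc n} A B f (z ∷ Z) = begin
  apply (A zero) z (act (A ∘ suc) (act B f ∘ (false ∷_)) Z) (act (A ∘ suc) (act B f ∘ (true ∷_)) Z)
    ≡⟨ cong₂ (apply (A zero) z) (pushed false) (pushed true) ⟩
  apply (A zero) z (apply (B zero) false X Y) (apply (B zero) true X Y)
    ≡⟨ sym (apply-· (A zero) (B zero) z X Y) ⟩
  apply (A zero · B zero) z X Y ∎
  where
  open ≡-Reasoning
  X Y : Bool
  X = act ((A ⊙ B) ∘ suc) (f ∘ (false ∷_)) Z
  Y = act ((A ⊙ B) ∘ suc) (f ∘ (true ∷_)) Z
  f₀ f₁ : Fam n
  f₀ = act (B ∘ suc) (f ∘ (false ∷_))
  f₁ = act (B ∘ suc) (f ∘ (true ∷_))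
  pushed : ∀ b → act (A ∘ suc) (act B f ∘ (b ∷_)) Z ≡ apply (B zero) b X Y
  pushed false = trans (act-linear (A ∘ suc) f₀ f₁ (Mat.m₀₀ (B zero)) (Mat.m₀₁ (B zero)) Z)
    (cong₂ (apply (B zero) false) (act-∘ (A ∘ suc) (B ∘ suc) _ Z) (act-∘ (A ∘ suc) (B ∘ suc) _ Z))
  pushed true = trans (act-linear (A ∘ suc) f₀ f₁ (Mat.m₁₀ (B zero)) (Mat.m₁₁ (B zero)) Z)
    (cong₂ (apply (B zero) true) (act-∘ (A ∘ suc) (B ∘ suc) _ Z) (act-∘ (A ∘ suc) (B ∘ suc) _ Z))

act-true : ∀ (A : Fin n → Mat) (f : Fam n) Z → act A f Z ≡ true → ∃ λ Z' → f Z' ≡ true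
act-true {zero}  A f Z h = Z , h
act-true {suc n} A f (z ∷ Z) h with apply-true (A zero) z _ _ h
... | inj₁ h' = let (W , e) = act-true (A ∘ suc) _ Z h' in false ∷ W , e
... | inj₂ h' = let (W , e) = act-true (A ∘ suc) _ Z h' in true ∷ W , e

act-single : ∀ (w : Fin n) m (f : Fam n) Z →
  act (onSet ⁅ w ⁆ m) f Z ≡ apply m (lookup Z w) (f (Z [ w ]≔ false)) (f (Z [ w ]≔ true))
act-single zero m f (z ∷ Z) =
  cong₂ (apply m z) (act-id (λ i → cong (λ b → when b m) (lookup-⊥ i)) Z) (act-id (λ i → cong (λ b → when b m) (lookup-⊥ i)) Z)
act-single (suc w) m f (false ∷ Z) = trans (xor-identityʳ _) (act-single w m (f ∘ (false ∷_)) Z)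
act-single (suc w) m f (true  ∷ Z) = act-single w m (f ∘ (true ∷_)) Z

act-single-⊥ : ∀ (w : Fin n) m (f : Fam n) → act (onSet ⁅ w ⁆ m) f ⊥ ≡ apply m false (f ⊥) (f ⁅ w ⁆)
act-single-⊥ w m f rewrite act-single w m f ⊥ | lookup-⊥ w | []≔true ⊥ w | ∪-identityˡ ⁅ w ⁆ =
  cong (λ Z → apply m false (f Z) (f ⁅ w ⁆)) (trans (cong (⊥ [ w ]≔_) (sym (lookup-⊥ w))) ([]≔-lookup ⊥ w))

act-pivot : ∀ (S : Subset n) (f : Fam n) Z → act (onSet S pivotM) f Z ≡ f (Z ⊕ S)
act-pivot []          f []          = refl
act-pivot (true  ∷ S) f (true  ∷ Z) rewrite act-pivot S (f ∘ (false ∷_)) Z = xor-identityʳ _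
act-pivot (true  ∷ S) f (false ∷ Z) rewrite act-pivot S (f ∘ (true ∷_)) Z = refl
act-pivot (false ∷ S) f (true  ∷ Z) rewrite act-pivot S (f ∘ (true ∷_)) Z = refl
act-pivot (false ∷ S) f (false ∷ Z) rewrite act-pivot S (f ∘ (false ∷_)) Z = xor-identityʳ _

act-delete : ∀ (S : Subset n) (f : Fam n) Z → act (onSet S deleteM) f Z ≡ f Z ∧ isEmpty (Z ∩ S)
act-delete []          f []          = sym (∧-identityʳ _)
act-delete (true  ∷ S) f (true  ∷ Z) = sym (∧-zeroʳ _)
act-delete (true  ∷ S) f (false ∷ Z) rewrite act-delete S (f ∘ (false ∷_)) Z = xor-identityʳ _
act-delete (false ∷ S) f (true  ∷ Z) rewrite act-delete S (f ∘ (true ∷_)) Z = refl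
act-delete (false ∷ S) f (false ∷ Z) rewrite act-delete S (f ∘ (false ∷_)) Z = xor-identityʳ _

act-loop : ∀ (w : Fin n) (f : Fam n) Z → act (onSet ⁅ w ⁆ loopM) f Z ≡ f Z xor (lookup Z w ∧ f (Z ─ ⁅ w ⁆))
act-loop w f Z = trans (act-single w loopM f Z) (row (lookup Z w) refl)
  where
  unchanged : ∀ {b} → lookup Z w ≡ b → Z [ w ]≔ b ≡ Z
  unchanged e = trans (cong (Z [ w ]≔_) (sym e)) ([]≔-lookup Z w)
  row : ∀ b → lookup Z w ≡ b →
        apply loopM b (f (Z [ w ]≔ false)) (f (Z [ w ]≔ true)) ≡ f Z xor (b ∧ f (Z ─ ⁅ w ⁆))
  row false e = cong (λ W → f W xor false) (unchanged e)
  row true  e rewrite unchanged e | []≔false Z w = xor-comm _ (f Z)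

act-loop-⊥ : ∀ (X : Subset n) (f : Fam n) → act (onSet X loopM) f ⊥ ≡ f ⊥
act-loop-⊥ []          f = refl
act-loop-⊥ (true  ∷ X) f = trans (xor-identityʳ _) (act-loop-⊥ X _)
act-loop-⊥ (false ∷ X) f = trans (xor-identityʳ _) (act-loop-⊥ X _)

act-vanishes : ∀ (A : Fin n → Mat) (f : Fam n) i → A i ≡ idM → (∀ Z → lookup Z i ≡ true → f Z ≡ false) →
  ∀ Z → lookup Z i ≡ true → act A f Z ≡ false
act-vanishes A f zero    A₀≡id f-vanishes (true ∷ Z) refl rewrite A₀≡id =
  trans (act-cong (λ _ → refl) (λ W → f-vanishes (true ∷ W) refl) Z) (act-linear (A ∘ suc) (f ∘ (true ∷_)) (f ∘ (true ∷_)) false false Z)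
act-vanishes A f (suc i) Aᵢ≡id f-vanishes (z ∷ Z) i∈Z
  rewrite act-vanishes (A ∘ suc) (f ∘ (false ∷_)) i Aᵢ≡id (λ W → f-vanishes (false ∷ W)) Z i∈Z
        | act-vanishes (A ∘ suc) (f ∘ (true ∷_)) i Aᵢ≡id (λ W → f-vanishes (true ∷ W)) Z i∈Z
  = apply-zero (A zero) z
  where
  apply-zero : ∀ m z → apply m z false false ≡ false
  apply-zero (mat a b c e) false rewrite ∧-zeroʳ a | ∧-zeroʳ b = refl
  apply-zero (mat a b c e) true  rewrite ∧-zeroʳ c | ∧-zeroʳ e = refl

act-pair-⊥ : ∀ (u v : Fin n) → u ≢ v → ∀ A B (f : Fam n) →
  act (onSet ⁅ u ⁆ A ⊙ onSet ⁅ v ⁆ B) f ⊥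
    ≡ apply A false (apply B false (f ⊥) (f ⁅ v ⁆)) (apply B false (f ⁅ u ⁆) (f (⁅ u ⁆ ∪ ⁅ v ⁆)))
act-pair-⊥ {n} u v u≢v A B f = begin
  act (onSet ⁅ u ⁆ A ⊙ onSet ⁅ v ⁆ B) f ⊥
    ≡⟨ sym (act-∘ (onSet ⁅ u ⁆ A) (onSet ⁅ v ⁆ B) f ⊥) ⟩
  act (onSet ⁅ u ⁆ A) g ⊥
    ≡⟨ act-single-⊥ u A g ⟩
  apply A false (g ⊥) (g ⁅ u ⁆)
    ≡⟨ cong₂ (apply A false) (act-single-⊥ v B f) (act-single v B f ⁅ u ⁆) ⟩
  apply A false (apply B false (f ⊥) (f ⁅ v ⁆)) (apply B (lookup ⁅ u ⁆ v) (f (⁅ u ⁆ [ v ]≔ false)) (f (⁅ u ⁆ [ v ]≔ true)))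
    ≡⟨ cong (apply A false _) (cong₂ (λ b W → apply B b (f W) (f (⁅ u ⁆ [ v ]≔ true))) v∉⁅u⁆ ⁅u⁆-unchanged) ⟩
  apply A false (apply B false (f ⊥) (f ⁅ v ⁆)) (apply B false (f ⁅ u ⁆) (f (⁅ u ⁆ [ v ]≔ true)))
    ≡⟨ cong (λ W → apply A false _ (apply B false (f ⁅ u ⁆) (f W))) ([]≔true ⁅ u ⁆ v) ⟩
  apply A false (apply B false (f ⊥) (f ⁅ v ⁆)) (apply B false (f ⁅ u ⁆) (f (⁅ u ⁆ ∪ ⁅ v ⁆))) ∎
  where
  open ≡-Reasoning
  g : Fam n
  g = act (onSet ⁅ v ⁆ B) f
  v∉⁅u⁆ : lookup ⁅ u ⁆ v ≡ false
  v∉⁅u⁆ = lookup-⁅⁆-≢ u v (u≢v ∘ sym)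
  ⁅u⁆-unchanged : ⁅ u ⁆ [ v ]≔ false ≡ ⁅ u ⁆
  ⁅u⁆-unchanged = trans (cong (⁅ u ⁆ [ v ]≔_) (sym v∉⁅u⁆)) ([]≔-lookup ⁅ u ⁆ v)

infix 4 _⟶[_]_
_⟶[_]_ : Fam n → (Fin n → Mat) → Fam n → Set
f ⟶[ A ] g = ∀ Z → g Z ≡ act A f Z

infixl 5 _⨾_
_⨾_ : ∀ {f g h : Fam n} {A B} → f ⟶[ A ] g → g ⟶[ B ] h → f ⟶[ B ⊙ A ] h
_⨾_ {f = f} {A = A} {B} p q Z = trans (q Z) (trans (act-cong (λ _ → refl) p Z) (act-∘ B A f Z))

⟶-resp : ∀ {f g : Fam n} {A B} → (∀ i → A i ≡ B i) → f ⟶[ A ] g → f ⟶[ B ] g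
⟶-resp A≡B p Z = trans (p Z) (act-cong A≡B (λ _ → refl) Z)

⟶-unique : ∀ {f g h : Fam n} {A B} → f ⟶[ A ] g → f ⟶[ B ] h → (∀ i → A i ≡ B i) → g ≗ h
⟶-unique p q A≡B Z = trans (⟶-resp A≡B p Z) (sym (q Z))

pivot⟶ : ∀ (K : SetSystem n) S → fam K ⟶[ onSet S pivotM ] fam (K * S)
pivot⟶ K S Z = sym (act-pivot S (fam K) Z)

delete⟶ : ∀ (K : SetSystem n) S → fam K ⟶[ onSet S deleteM ] fam (K ∖ S)
delete⟶ K S Z = sym (act-delete S (fam K) Z)

loop⟶ : ∀ (K : SetSystem n) w → fam K ⟶[ onSet ⁅ w ⁆ loopM ] fam (K +w w)
loop⟶ K w Z = sym (act-loop w (fam K) Z)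

dualPivot⟶ : ∀ (K : SetSystem n) w → fam K ⟶[ onSet ⁅ w ⁆ dualM ] fam (K *̄w w)
dualPivot⟶ K w = ⟶-resp merge (loop⟶ K w ⨾ pivot⟶ (K +w w) ⁅ w ⁆ ⨾ loop⟶ ((K +w w) *w w) w)
  where
  merge : ∀ i → onSet ⁅ w ⁆ loopM i · (onSet ⁅ w ⁆ pivotM i · onSet ⁅ w ⁆ loopM i) ≡ onSet ⁅ w ⁆ dualM i
  merge i with lookup ⁅ w ⁆ i
  ... | true  = refl
  ... | false = refl

·-identityˡ : ∀ B → idM · B ≡ B
·-identityˡ (mat a b c e) = cong₂ (λ x y → mat x y c e) (xor-identityʳ a) (xor-identityʳ b)

·-identityʳ : ∀ A → A · idM ≡ A
·-identityʳ (mat a b c e)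
  rewrite ∧-identityʳ a | ∧-zeroʳ a | ∧-identityʳ b | ∧-zeroʳ b | ∧-identityʳ c | ∧-zeroʳ c | ∧-identityʳ e | ∧-zeroʳ e =
  cong₂ (λ x y → mat x b y e) (xor-identityʳ a) (xor-identityʳ c)

when-idM : ∀ b → when b idM ≡ idM
when-idM true  = refl
when-idM false = refl

applySeq-++ : ∀ (M : SetSystem n) φ ψ → applySeq M (φ ++ ψ) ≡ applySeq (applySeq M φ) ψ
applySeq-++ M []      ψ = refl
applySeq-++ M (o ∷ φ) ψ = applySeq-++ (applyOp M o) φ ψ

module Elementwise
  (op : ∀ {n} → SetSystem n → Fin n → SetSystem n)
  (m : Mat)
  (op⟶ : ∀ {n} (K : SetSystem n) w → fam K ⟶[ onSet ⁅ w ⁆ m ] fam (op K w))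
  (op-ground : ∀ {n} (K : SetSystem n) w → ground (op K w) ≡ ground K)
  (elementary : ∀ {n} → Fin n → List (Op n))
  (elementary-applies : ∀ {n} (K : SetSystem n) w → applySeq K (elementary w) ≡ op K w)
  (elementary-on : ∀ {n} {V : Subset n} w → w ∈ V → All (λ o → opElem o ∈ V) (elementary w))
  where

  step : Subset n → Fin n → SetSystem n → SetSystem n
  step X i K = if lookup X i then op K i else K

  factors : Subset n → List (Fin n) → Fin n → Mat
  factors X []      i = idM
  factors X (j ∷ l) i = when (lookup X j) (onSet ⁅ j ⁆ m i) · factors X l i

  foldr⟶ : ∀ (M : SetSystem n) X l → fam M ⟶[ factors X l ] fam (List.foldr (step X) M l)
  foldr⟶ M X []      Z = sym (act-id (λ _ → refl) Z)
  foldr⟶ M X (j ∷ l) with lookup X j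
  ... | true  = foldr⟶ M X l ⨾ op⟶ _ j
  ... | false = ⟶-resp (λ i → sym (·-identityˡ _)) (foldr⟶ M X l)

  factors-outside : ∀ {k} x (X : Subset n) (h : Fin k → Fin n) →
    factors (x ∷ X) (List.tabulate (suc ∘ h)) zero ≡ idM
  factors-outside {k = zero}  x X h = refl
  factors-outside {k = suc k} x X h
    rewrite factors-outside x X (h ∘ suc) | when-idM (lookup X (h zero)) = refl

  factors-shift : ∀ {k} x (X : Subset n) (h : Fin k → Fin n) i →
    factors (x ∷ X) (List.tabulate (suc ∘ h)) (suc i) ≡ factors X (List.tabulate h) i
  factors-shift {k = zero}  x X h i = refl
  factors-shift {k = suc k} x X h i =
    cong (when (lookup X (h zero)) (onSet ⁅ h zero ⁆ m i) ·_) (factors-shift x X (h ∘ suc) i)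

  factors-allFin : ∀ (X : Subset n) i → factors X (List.allFin n) i ≡ onSet X m i
  factors-allFin (x ∷ X) zero    rewrite factors-outside x X id = ·-identityʳ _
  factors-allFin (x ∷ X) (suc i) rewrite factors-shift x X id i | lookup-⊥ i | when-idM x =
    trans (·-identityˡ _) (factors-allFin X i)

  forEach⟶ : ∀ (M : SetSystem n) X → fam M ⟶[ onSet X m ] fam (forEach op M X)
  forEach⟶ M X = ⟶-resp (factors-allFin X) (foldr⟶ M X (List.allFin _))

  forEach-ground : ∀ (M : SetSystem n) X → ground (forEach op M X) ≡ ground M
  forEach-ground M X = go (List.allFin _)
    where
    go : ∀ l → ground (List.foldr (step X) M l) ≡ ground M
    go []      = refl
    go (j ∷ l) with lookup X j
    ... | true  = trans (op-ground _ j) (go l)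
    ... | false = go l

  elementaries : Subset n → List (Fin n) → List (Op n)
  elementaries X []      = []
  elementaries X (j ∷ l) = elementaries X l ++ (if lookup X j then elementary j else [])

  foldr-applySeq : ∀ (M : SetSystem n) X l → List.foldr (step X) M l ≡ applySeq M (elementaries X l)
  foldr-applySeq M X [] = refl
  foldr-applySeq M X (j ∷ l)
    rewrite applySeq-++ M (elementaries X l) (if lookup X j then elementary j else []) | sym (foldr-applySeq M X l)
    with lookup X j
  ... | true  = sym (elementary-applies _ j)
  ... | false = refl

  elementaries-on : ∀ {V X : Subset n} → X ⊆ V → ∀ l → All (λ o → opElem o ∈ V) (elementaries X l)
  elementaries-on X⊆V []      = []
  elementaries-on {X = X} X⊆V (j ∷ l) = ++⁺ (elementaries-on X⊆V l) (last (lookup X j) refl)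
    where
    last : ∀ b → lookup X j ≡ b → All (λ o → opElem o ∈ _) (if b then elementary j else [])
    last true  e = elementary-on j (X⊆V (lookup⇒[]= j X e))
    last false e = []

  forEach-Δ : ∀ (M : SetSystem n) X → VfClosed M → X ⊆ ground M →
    ∀ ψ → All (λ o → opElem o ∈ ground M) ψ → IsΔMatroid (applySeq (forEach op M X) ψ)
  forEach-Δ M X vf X⊆V ψ ψ-on
    rewrite foldr-applySeq M X (List.allFin _) | sym (applySeq-++ M (elementaries X (List.allFin _)) ψ) =
    vf _ (++⁺ (elementaries-on X⊆V (List.allFin _)) ψ-on)

module Loops = Elementwise _+w_ loopM loop⟶ (λ K w → refl) (λ w → loop w ∷ []) (λ K w → refl) (λ w w∈V → w∈V ∷ [])
module DualPivots = Elementwise _*̄w_ dualM dualPivot⟶ (λ K w → refl)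
  (λ w → loop w ∷ piv w ∷ loop w ∷ []) (λ K w → refl) (λ w w∈V → w∈V ∷ w∈V ∷ w∈V ∷ [])

-- Minimal distance and the exchange axiom

subsets-complete : ∀ (Z : Subset n) → Z ∈ₗ subsets n
subsets-complete []          = here refl
subsets-complete {suc n} (true  ∷ Z) = ∈-++⁺ˡ (∈-map⁺ (true ∷_) (subsets-complete Z))
subsets-complete {suc n} (false ∷ Z) = ∈-++⁺ʳ (map (true ∷_) (subsets n)) (∈-map⁺ (false ∷_) (subsets-complete Z))

module _ (K : SetSystem n) where

  private
    minOver : List (Subset n) → ℕ
    minOver = List.foldr (λ Z acc → if fam K Z then ∣ ⊥ ⊕ Z ∣ ⊓ acc else acc) n

    minOver-≤ : ∀ l Z → Z ∈ₗ l → Z ∈M K → minOver l ≤ ∣ ⊥ ⊕ Z ∣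
    minOver-≤ (x ∷ l) Z (here refl) Z∈K rewrite Z∈K = m⊓n≤m _ _
    minOver-≤ (x ∷ l) Z (there Z∈l) Z∈K with fam K x
    ... | true  = ≤-trans (m⊓n≤n _ _) (minOver-≤ l Z Z∈l Z∈K)
    ... | false = minOver-≤ l Z Z∈l Z∈K

    minOver-attained : ∀ l → minOver l ≡ n ⊎ ∃ λ Z → Z ∈M K × minOver l ≡ ∣ ⊥ ⊕ Z ∣
    minOver-attained [] = inj₁ refl
    minOver-attained (x ∷ l) with fam K x in x∈K
    ... | false = minOver-attained l
    ... | true with ⊓-sel ∣ ⊥ ⊕ x ∣ (minOver l)
    ...   | inj₁ e = inj₂ (x , x∈K , e)
    ...   | inj₂ e with minOver-attained l
    ...     | inj₁ e′ = inj₁ (trans e e′)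
    ...     | inj₂ (Z , Z∈K , e′) = inj₂ (Z , Z∈K , trans e e′)

  d-≤ : ∀ Z → Z ∈M K → d K ≤ ∣ Z ∣
  d-≤ Z Z∈K = subst (λ W → d K ≤ ∣ W ∣) (⊕-identityˡ Z) (minOver-≤ (subsets n) Z (subsets-complete Z) Z∈K)

  d-attained : ∀ Z → Z ∈M K → ∃ λ Z′ → Z′ ∈M K × d K ≡ ∣ Z′ ∣
  d-attained Z Z∈K with minOver-attained (subsets n)
  ... | inj₂ (Z′ , Z′∈K , e) = Z′ , Z′∈K , trans e (cong ∣_∣ (⊕-identityˡ Z′))
  ... | inj₁ e = Z , Z∈K , ≤-antisym (d-≤ Z Z∈K) (subst (∣ Z ∣ ≤_) (sym e) (∣p∣≤n Z))

d-cong : ∀ (K K′ : SetSystem n) → fam K ≗ fam K′ → d K ≡ d K′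
d-cong {n} K K′ K≗K′ = go (subsets n)
  where
  go : ∀ l → List.foldr (λ Z acc → if fam K Z then ∣ ⊥ ⊕ Z ∣ ⊓ acc else acc) n l
           ≡ List.foldr (λ Z acc → if fam K′ Z then ∣ ⊥ ⊕ Z ∣ ⊓ acc else acc) n l
  go []      = refl
  go (x ∷ l) rewrite K≗K′ x | go l = refl

Dominates : SetSystem n → SetSystem n → Set
Dominates K K′ = ∀ Z → Z ∈M K′ → ∃ λ Z′ → Z′ ∈M K × ∣ Z′ ∣ ≤ ∣ Z ∣

d-≡ : ∀ (K K′ : SetSystem n) Z → Z ∈M K → Dominates K K′ → Dominates K′ K → d K ≡ d K′
d-≡ K K′ Z Z∈K K-dom K′-dom with d-attained K Z Z∈K
... | Z₁ , Z₁∈K , e₁ with K′-dom Z₁ Z₁∈K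
... | Z₂ , Z₂∈K′ , Z₂≤Z₁ with d-attained K′ Z₂ Z₂∈K′
... | Z₃ , Z₃∈K′ , e₃ with K-dom Z₃ Z₃∈K′
... | Z₄ , Z₄∈K , Z₄≤Z₃ =
  ≤-antisym (≤-trans (d-≤ K Z₄ Z₄∈K) (subst (∣ Z₄ ∣ ≤_) (sym e₃) Z₄≤Z₃))
            (≤-trans (d-≤ K′ Z₂ Z₂∈K′) (subst (∣ Z₂ ∣ ≤_) (sym e₁) Z₂≤Z₁))

ExchangeStep : SetSystem n → Subset n → Subset n → Fin n → Set
ExchangeStep M X Y w = ((X ⊕ ⁅ w ⁆) ∈M M) ⊎ (∃ λ v → v ∈ (X ⊕ Y) × v ≢ w × ((X ⊕ (⁅ w ⁆ ∪ ⁅ v ⁆)) ∈M M))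

-- Definitionally the second component of IsΔMatroid.
Exchange : SetSystem n → Set
Exchange M = ∀ X Y → X ∈M M → Y ∈M M → ∀ w → w ∈ (X ⊕ Y) → ExchangeStep M X Y w

∈-∖w : ∀ (K : SetSystem n) Z u → Z ∈M K → lookup Z u ≡ false → Z ∈M (K ∖w u)
∈-∖w K Z u Z∈K u∉Z rewrite Z∈K | isEmpty-∩⁅⁆ Z u | u∉Z = refl

∖w-∈ : ∀ (K : SetSystem n) Z u → Z ∈M (K ∖w u) → Z ∈M K × lookup Z u ≡ false
∖w-∈ K Z u Z∈K∖u =
  ∧-conicalˡ _ _ Z∈K∖u ,
  trans (sym (not-involutive _)) (cong not (trans (sym (isEmpty-∩⁅⁆ Z u)) (∧-conicalʳ _ _ Z∈K∖u)))

pivot-exchange : ∀ (N : SetSystem n) A → Exchange N → Exchange (N * A)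
pivot-exchange N A ex X Y X∈ Y∈ w w∈ = result (ex (X ⊕ A) (Y ⊕ A) X∈ Y∈ w (subst (w ∈_) (sym cancel) w∈))
  where
  cancel : (X ⊕ A) ⊕ (Y ⊕ A) ≡ X ⊕ Y
  cancel = begin
    (X ⊕ A) ⊕ (Y ⊕ A) ≡⟨ ⊕-swap X A (Y ⊕ A) ⟩
    (X ⊕ (Y ⊕ A)) ⊕ A ≡⟨ cong (_⊕ A) (sym (⊕-assoc X Y A)) ⟩
    ((X ⊕ Y) ⊕ A) ⊕ A ≡⟨ ⊕-cancelʳ (X ⊕ Y) A ⟩
    X ⊕ Y             ∎
    where open ≡-Reasoning
  moved : ∀ T → ((X ⊕ A) ⊕ T) ∈M N → (X ⊕ T) ∈M (N * A)
  moved T = subst (λ W → fam N W ≡ true) (⊕-swap X A T)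
  result : ExchangeStep N (X ⊕ A) (Y ⊕ A) w → ExchangeStep (N * A) X Y w
  result (inj₁ h)                  = inj₁ (moved ⁅ w ⁆ h)
  result (inj₂ (v , v∈ , v≢w , h)) = inj₂ (v , subst (v ∈_) cancel v∈ , v≢w , moved _ h)

∖w-exchange : ∀ (N : SetSystem n) u → Exchange N → Exchange (N ∖w u)
∖w-exchange N u ex X Y X∈ Y∈ w w∈ = result (ex X Y (proj₁ (∖w-∈ N X u X∈)) (proj₁ (∖w-∈ N Y u Y∈)) w w∈)
  where
  Xᵤ : lookup X u ≡ false
  Xᵤ = proj₂ (∖w-∈ N X u X∈)
  Yᵤ : lookup Y u ≡ false
  Yᵤ = proj₂ (∖w-∈ N Y u Y∈)
  outside : ∀ {x} → x ∈ (X ⊕ Y) → x ≢ u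
  outside x∈ refl = not-¬ ([]=⇒lookup x∈) (trans (lookup-⊕ X Y u) (cong₂ _xor_ Xᵤ Yᵤ))
  avoids : ∀ {x} → x ∈ (X ⊕ Y) → lookup ⁅ x ⁆ u ≡ false
  avoids x∈ = lookup-⁅⁆-≢ _ u (outside x∈ ∘ sym)
  keeps : ∀ T → lookup T u ≡ false → (X ⊕ T) ∈M N → (X ⊕ T) ∈M (N ∖w u)
  keeps T Tᵤ h = ∈-∖w N (X ⊕ T) u h (trans (lookup-⊕ X T u) (cong₂ _xor_ Xᵤ Tᵤ))
  result : ExchangeStep N X Y w → ExchangeStep (N ∖w u) X Y w
  result (inj₁ h) = inj₁ (keeps ⁅ w ⁆ (avoids w∈) h)
  result (inj₂ (v , v∈ , v≢w , h)) =
    inj₂ (v , v∈ , v≢w , keeps (⁅ w ⁆ ∪ ⁅ v ⁆) (trans (lookup-∪ ⁅ w ⁆ ⁅ v ⁆ u) (cong₂ _∨_ (avoids w∈) (avoids v∈))) h)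

d-∖w : ∀ (K : SetSystem n) {R} u → Exchange K → R ∈M K → lookup R u ≡ false → d (K ∖w u) ≡ d K
d-∖w K {R} u ex R∈ u∉R = d-≡ (K ∖w u) K R (∈-∖w K R u R∈ u∉R) avoid keep
  where
  keep : Dominates K (K ∖w u)
  keep Z Z∈ = Z , proj₁ (∖w-∈ K Z u Z∈) , ≤-refl
  avoid : Dominates (K ∖w u) K
  avoid Z Z∈ with lookup Z u in Zᵤ
  ... | false = Z , ∈-∖w K Z u Z∈ Zᵤ , ≤-refl
  ... | true  = shrink (ex Z R Z∈ R∈ u (lookup⇒[]= u _ (trans (lookup-⊕ Z R u) (cong₂ _xor_ Zᵤ u∉R))))
    where
    shrink : ExchangeStep K Z R u → ∃ λ Z′ → Z′ ∈M (K ∖w u) × ∣ Z′ ∣ ≤ ∣ Z ∣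
    shrink (inj₁ h) =
      Z ⊕ ⁅ u ⁆ ,
      ∈-∖w K _ u h (trans (lookup-⊕ Z ⁅ u ⁆ u) (cong₂ _xor_ Zᵤ (lookup-⁅⁆-self u))) ,
      ∣⊕⁅⁆∣-≤-∈ Z u Zᵤ
    shrink (inj₂ (v , _ , v≢u , h)) =
      Z ⊕ (⁅ u ⁆ ∪ ⁅ v ⁆) ,
      ∈-∖w K _ u h (trans (lookup-⊕ Z _ u)
                          (cong₂ _xor_ Zᵤ (trans (lookup-∪ ⁅ u ⁆ ⁅ v ⁆ u) (cong (_∨ lookup ⁅ v ⁆ u) (lookup-⁅⁆-self u))))) ,
      ∣⊕⁅⁆∪⁅⁆∣-≤-∈ Z u v Zᵤ v≢u

∖w-*-comm : ∀ (N : SetSystem n) u A → lookup A u ≡ false → fam ((N ∖w u) * A) ≗ fam ((N * A) ∖w u)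
∖w-*-comm N u A u∉A Z = cong (fam N (Z ⊕ A) ∧_) (begin
  isEmpty ((Z ⊕ A) ∩ ⁅ u ⁆)       ≡⟨ isEmpty-∩⁅⁆ (Z ⊕ A) u ⟩
  not (lookup (Z ⊕ A) u)          ≡⟨ cong not (lookup-⊕ Z A u) ⟩
  not (lookup Z u xor lookup A u) ≡⟨ cong (λ b → not (lookup Z u xor b)) u∉A ⟩
  not (lookup Z u xor false)      ≡⟨ cong not (xor-identityʳ _) ⟩
  not (lookup Z u)                ≡⟨ sym (isEmpty-∩⁅⁆ Z u) ⟩
  isEmpty (Z ∩ ⁅ u ⁆)             ∎)
  where open ≡-Reasoning

d-pivot-∖w : ∀ (N : SetSystem n) {R} u A → Exchange N → R ∈M N → lookup R u ≡ false → lookup A u ≡ false →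
  d ((N ∖w u) * A) ≡ d (N * A)
d-pivot-∖w N {R} u A ex R∈ u∉R u∉A =
  trans (d-cong ((N ∖w u) * A) ((N * A) ∖w u) (∖w-*-comm N u A u∉A)) (d-∖w (N * A) u (pivot-exchange N A ex) R⊕A∈ u∉R⊕A)
  where
  R⊕A∈ : (R ⊕ A) ∈M (N * A)
  R⊕A∈ = subst (λ W → fam N W ≡ true) (sym (⊕-cancelʳ R A)) R∈
  u∉R⊕A : lookup (R ⊕ A) u ≡ false
  u∉R⊕A = trans (lookup-⊕ R A u) (cong₂ _xor_ u∉R u∉A)

-- Counting

countᵇ : ∀ {A : Set} → (A → Bool) → List A → ℕ
countᵇ p []       = 0
countᵇ p (x ∷ xs) = if p x then suc (countᵇ p xs) else countᵇ p xs

length-filter : ∀ {A : Set} {ℓ} {P : Pred A ℓ} (P? : Decidable P) xs → length (filter P? xs) ≡ countᵇ (does ∘ P?) xs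
length-filter P? []       = refl
length-filter P? (x ∷ xs) with does (P? x)
... | true  = cong suc (length-filter P? xs)
... | false = length-filter P? xs

countᵇ-cong : ∀ {A : Set} {p q : A → Bool} → p ≗ q → ∀ xs → countᵇ p xs ≡ countᵇ q xs
countᵇ-cong p≗q []       = refl
countᵇ-cong p≗q (x ∷ xs) rewrite p≗q x | countᵇ-cong p≗q xs = refl

countᵇ-split : ∀ {A : Set} (p q : A → Bool) xs →
  countᵇ p xs ≡ countᵇ (λ x → p x ∧ not (q x)) xs ℕ.+ countᵇ (λ x → p x ∧ q x) xs
countᵇ-split p q [] = refl
countᵇ-split p q (x ∷ xs) with p x | q x | countᵇ-split p q xs
... | true  | true  | e = trans (cong suc e) (sym (+-suc _ _))
... | true  | false | e = cong suc e
... | false | true  | e = e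
... | false | false | e = e

countᵇ-++ : ∀ {A : Set} (p : A → Bool) xs ys → countᵇ p (xs ++ ys) ≡ countᵇ p xs ℕ.+ countᵇ p ys
countᵇ-++ p []       ys = refl
countᵇ-++ p (x ∷ xs) ys with p x
... | true  = cong suc (countᵇ-++ p xs ys)
... | false = countᵇ-++ p xs ys

countᵇ-map : ∀ {A B : Set} (p : B → Bool) (f : A → B) xs → countᵇ p (map f xs) ≡ countᵇ (p ∘ f) xs
countᵇ-map p f []       = refl
countᵇ-map p f (x ∷ xs) with p (f x)
... | true  = cong suc (countᵇ-map p f xs)
... | false = countᵇ-map p f xs

countᵇ-subsets : ∀ (p : Subset (suc n) → Bool) →
  countᵇ p (subsets (suc n)) ≡ countᵇ (p ∘ (true ∷_)) (subsets n) ℕ.+ countᵇ (p ∘ (false ∷_)) (subsets n)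
countᵇ-subsets {n} p =
  trans (countᵇ-++ p (map (true ∷_) (subsets n)) (map (false ∷_) (subsets n)))
        (cong₂ ℕ._+_ (countᵇ-map p (true ∷_) (subsets n)) (countᵇ-map p (false ∷_) (subsets n)))

countᵇ-⊕ : ∀ (p : Subset n → Bool) S → countᵇ p (subsets n) ≡ countᵇ (λ A → p (A ⊕ S)) (subsets n)
countᵇ-⊕ {zero}  p []      = refl
countᵇ-⊕ {suc n} p (s ∷ S) =
  trans (countᵇ-subsets p) (trans (halves s) (sym (countᵇ-subsets (λ A → p (A ⊕ (s ∷ S))))))
  where
  shifted : ∀ b → countᵇ (p ∘ (b ∷_)) (subsets n) ≡ countᵇ (λ A → p (b ∷ (A ⊕ S))) (subsets n)
  shifted b = countᵇ-⊕ (p ∘ (b ∷_)) S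
  halves : ∀ s → countᵇ (p ∘ (true ∷_)) (subsets n) ℕ.+ countᵇ (p ∘ (false ∷_)) (subsets n)
               ≡ countᵇ (λ A → p ((true xor s) ∷ (A ⊕ S))) (subsets n) ℕ.+ countᵇ (λ A → p ((false xor s) ∷ (A ⊕ S))) (subsets n)
  halves false = cong₂ ℕ._+_ (shifted true) (shifted false)
  halves true  = trans (+-comm (countᵇ (p ∘ (true ∷_)) (subsets n)) _) (cong₂ ℕ._+_ (shifted false) (shifted true))

infix 4 _⊆ᵇ_
_⊆ᵇ_ : Subset n → Subset n → Bool
[]      ⊆ᵇ []      = true
(x ∷ X) ⊆ᵇ (v ∷ V) = (not x ∨ v) ∧ (X ⊆ᵇ V)

does-⊆? : ∀ (X V : Subset n) → does (X ⊆? V) ≡ (X ⊆ᵇ V)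
does-⊆? []          []          = refl
does-⊆? (true  ∷ X) (true  ∷ V) = does-⊆? X V
does-⊆? (true  ∷ X) (false ∷ V) = refl
does-⊆? (false ∷ X) (v     ∷ V) = does-⊆? X V

⊆ᵇ-⊕ : ∀ (A S V : Subset n) → S ⊆ V → (A ⊕ S ⊆ᵇ V) ≡ (A ⊆ᵇ V)
⊆ᵇ-⊕ []      []          []      S⊆V = refl
⊆ᵇ-⊕ (a ∷ A) (true  ∷ S) (v ∷ V) S⊆V with S⊆V Data.Vec.here
⊆ᵇ-⊕ (true  ∷ A) (true ∷ S) (true ∷ V) S⊆V | Data.Vec.here = ⊆ᵇ-⊕ A S V (drop-∷-⊆ S⊆V)
⊆ᵇ-⊕ (false ∷ A) (true ∷ S) (true ∷ V) S⊆V | Data.Vec.here = ⊆ᵇ-⊕ A S V (drop-∷-⊆ S⊆V)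
⊆ᵇ-⊕ (a ∷ A) (false ∷ S) (v ∷ V) S⊆V rewrite xor-identityʳ a | ⊆ᵇ-⊕ A S V (drop-∷-⊆ S⊆V) = refl

⊆ᵇ-ext : ∀ (A W W′ : Subset n) → (∀ i → lookup A i ≡ true → lookup W i ≡ lookup W′ i) → (A ⊆ᵇ W) ≡ (A ⊆ᵇ W′)
⊆ᵇ-ext []          []      []        h = refl
⊆ᵇ-ext (true  ∷ A) (w ∷ W) (w′ ∷ W′) h rewrite h zero refl = cong (w′ ∧_) (⊆ᵇ-ext A W W′ (h ∘ suc))
⊆ᵇ-ext (false ∷ A) (w ∷ W) (w′ ∷ W′) h = ⊆ᵇ-ext A W W′ (h ∘ suc)

⊆ᵇ-false : ∀ (A W : Subset n) i → lookup A i ≡ true → lookup W i ≡ false → (A ⊆ᵇ W) ≡ false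
⊆ᵇ-false (a ∷ A) (w ∷ W) zero    refl refl = refl
⊆ᵇ-false (a ∷ A) (w ∷ W) (suc i) p q rewrite ⊆ᵇ-false A W i p q = ∧-zeroʳ _

⊆ᵇ-─⁅⁆-∉ : ∀ (A V : Subset n) u → lookup A u ≡ false → (A ⊆ᵇ V ─ ⁅ u ⁆) ≡ (A ⊆ᵇ V)
⊆ᵇ-─⁅⁆-∉ A V u u∉A = ⊆ᵇ-ext A (V ─ ⁅ u ⁆) V λ i i∈A →
  trans (lookup-─ V ⁅ u ⁆ i)
    (cong (λ b → if b then false else lookup V i) (lookup-⁅⁆-≢ u i λ { refl → not-¬ i∈A u∉A }))

⊆ᵇ-─⁅⁆-∈ : ∀ (A V : Subset n) u → lookup A u ≡ true → (A ⊆ᵇ V ─ ⁅ u ⁆) ≡ false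
⊆ᵇ-─⁅⁆-∈ A V u u∈A =
  ⊆ᵇ-false A (V ─ ⁅ u ⁆) u u∈A (trans (lookup-─ V ⁅ u ⁆ u) (cong (λ b → if b then false else lookup V u) (lookup-⁅⁆-self u)))

atDistance : SetSystem n → ℕ → Subset n → Bool
atDistance N k X = (X ⊆ᵇ ground N) ∧ does (d (N * X) ≟ k)

q₁-countᵇ : ∀ (N : SetSystem n) k → q₁ N k ≡ countᵇ (atDistance N k) (subsets n)
q₁-countᵇ {n} N k =
  trans (length-filter (λ X → (X ⊆? ground N) ×-dec (d (N * X) ≟ k)) (subsets n))
        (countᵇ-cong (λ X → cong (_∧ does (d (N * X) ≟ k)) (does-⊆? X (ground N))) (subsets n))

q₁-cong : ∀ (K K′ : SetSystem n) → ground K ≡ ground K′ → fam K ≗ fam K′ → ∀ k → q₁ K k ≡ q₁ K′ k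
q₁-cong {n} K K′ same-ground same-fam k =
  trans (q₁-countᵇ K k)
    (trans (countᵇ-cong (λ X → cong₂ (λ V m → (X ⊆ᵇ V) ∧ does (m ≟ k)) same-ground
                                  (d-cong (K * X) (K′ * X) (λ Z → same-fam (Z ⊕ X)))) (subsets n))
           (sym (q₁-countᵇ K′ k)))

q₁-split : ∀ (N : SetSystem n) u S {P Q} → Exchange N →
  P ∈M N → lookup P u ≡ false → Q ∈M N → lookup Q u ≡ true → S ⊆ ground N → lookup S u ≡ true →
  ∀ k → q₁ N k ≡ q₁ (N ∖w u) k ℕ.+ q₁ ((N * S) ∖w u) k
q₁-split {n} N u S {P} {Q} ex P∈ u∉P Q∈ u∈Q S⊆V u∈S k = begin
  q₁ N k
    ≡⟨ q₁-countᵇ N k ⟩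
  countᵇ (atDistance N k) (subsets n)
    ≡⟨ countᵇ-split (atDistance N k) (λ A → lookup A u) (subsets n) ⟩
  countᵇ (λ A → atDistance N k A ∧ not (lookup A u)) (subsets n) ℕ.+ countᵇ (λ A → atDistance N k A ∧ lookup A u) (subsets n)
    ≡⟨ cong₂ ℕ._+_ (countᵇ-cong avoiding (subsets n))
                   (trans (countᵇ-⊕ _ S) (countᵇ-cong containing (subsets n))) ⟩
  countᵇ (atDistance (N ∖w u) k) (subsets n) ℕ.+ countᵇ (atDistance ((N * S) ∖w u) k) (subsets n)
    ≡⟨ sym (cong₂ ℕ._+_ (q₁-countᵇ (N ∖w u) k) (q₁-countᵇ ((N * S) ∖w u) k)) ⟩
  q₁ (N ∖w u) k ℕ.+ q₁ ((N * S) ∖w u) k ∎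
  where
  open ≡-Reasoning
  V : Subset n
  V = ground N
  Q⊕S∈ : (Q ⊕ S) ∈M (N * S)
  Q⊕S∈ = subst (λ W → fam N W ≡ true) (sym (⊕-cancelʳ Q S)) Q∈
  avoiding : ∀ A → atDistance N k A ∧ not (lookup A u) ≡ atDistance (N ∖w u) k A
  avoiding A with lookup A u in Aᵤ
  ... | true  rewrite ⊆ᵇ-─⁅⁆-∈ A V u Aᵤ = ∧-zeroʳ _
  ... | false rewrite ⊆ᵇ-─⁅⁆-∉ A V u Aᵤ | d-pivot-∖w N u A ex P∈ u∉P Aᵤ = ∧-identityʳ _
  containing : ∀ A → atDistance N k (A ⊕ S) ∧ lookup (A ⊕ S) u ≡ atDistance ((N * S) ∖w u) k A
  containing A rewrite lookup-⊕ A S u | u∈S with lookup A u in Aᵤ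
  ... | true  rewrite ⊆ᵇ-─⁅⁆-∈ A V u Aᵤ = ∧-zeroʳ _
  ... | false
    rewrite ⊆ᵇ-─⁅⁆-∉ A V u Aᵤ | ⊆ᵇ-⊕ A S V S⊆V
          | d-pivot-∖w (N * S) u A (pivot-exchange N S ex) Q⊕S∈
              (trans (lookup-⊕ Q S u) (cong₂ _xor_ u∈Q u∈S)) Aᵤ
          | d-cong (N * (A ⊕ S)) ((N * S) * A) (λ Z → cong (fam N) (sym (⊕-assoc Z A S)))
    = ∧-identityʳ _

-- The recurrences

∖-normal : ∀ (K : SetSystem n) S → Normal K → Normal (K ∖ S)
∖-normal K S K-normal = cong₂ _∧_ K-normal (isEmpty-⊥∩ S)

*-normal : ∀ (K : SetSystem n) {X} → X ∈M K → Normal (K * X)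
*-normal K {X} X∈K = trans (cong (fam K) (⊕-identityˡ X)) X∈K

+-⊥ : ∀ (K : SetSystem n) X → fam (K + X) ⊥ ≡ fam K ⊥
+-⊥ K X = trans (Loops.forEach⟶ K X ⊥) (act-loop-⊥ X (fam K))

*̄-normal⇒proper : ∀ (K : SetSystem n) X → Normal (K *̄ X) → Proper K
*̄-normal⇒proper K X normal = act-true (onSet X dualM) (fam K) ⊥ (trans (sym (DualPivots.forEach⟶ K X ⊥)) normal)

⟶-wellFormed : ∀ (K K′ : SetSystem n) A → ground K′ ≡ ground K → WellFormed K → fam K ⟶[ A ] fam K′ →
  (∀ i → lookup (ground K) i ≡ false → A i ≡ idM) → WellFormed K′
⟶-wellFormed K K′ A same-ground K-wf K⟶K′ identity-outside Z Z∈K′ {i} i∈Z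
  rewrite same-ground with lookup (ground K) i in i∈V
... | true  = lookup⇒[]= i (ground K) i∈V
... | false = ⊥-elim (not-¬ Z∈K′ (trans (K⟶K′ Z) (act-vanishes A (fam K) i (identity-outside i i∈V) vanishes Z ([]=⇒lookup i∈Z))))
  where
  vanishes : ∀ W → lookup W i ≡ true → fam K W ≡ false
  vanishes W i∈W = ¬-not λ W∈K → not-¬ ([]=⇒lookup (K-wf W W∈K (lookup⇒[]= i W i∈W))) i∈V

q₁-recurrence : ∀ (M : SetSystem n) → WellFormed M → Normal M → VfClosed M → ∀ u X → X ∈M M → u ∈ X →
  (∀ k → q₁ M k ≡ (q₁ (M ∖w u) ⊞ q₁ ((M * X) ∖w u)) k) × Normal (M ∖w u) × Normal ((M * X) ∖w u)
q₁-recurrence M M-wf M-normal vf u X X∈M u∈X =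
  q₁-split M u X (proj₂ (vf [] [])) M-normal (lookup-⊥ u) X∈M ([]=⇒lookup u∈X) (M-wf X X∈M) ([]=⇒lookup u∈X) ,
  ∖-normal M ⁅ u ⁆ M-normal ,
  ∖-normal (M * X) ⁅ u ⁆ (*-normal M X∈M)

sumM shiftM : Mat
sumM   = mat true  true false false
shiftM = mat false true false false

*̄⁅⁆-⊥ : ∀ (K : SetSystem n) w → fam (K *̄ ⁅ w ⁆) ⊥ ≡ fam K ⊥ xor fam K ⁅ w ⁆
*̄⁅⁆-⊥ K w = trans (DualPivots.forEach⟶ K ⁅ w ⁆ ⊥) (act-single-⊥ w dualM (fam K))

pivot-∖w-∈ : ∀ (K : SetSystem n) w Z → Z ∈M ((K * ⁅ w ⁆) ∖w w) → (Z ⊕ ⁅ w ⁆) ∈M K × lookup (Z ⊕ ⁅ w ⁆) w ≡ true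
pivot-∖w-∈ K w Z Z∈ with ∖w-∈ (K * ⁅ w ⁆) Z w Z∈
... | Z⊕w∈K , w∉Z = Z⊕w∈K , trans (lookup-⊕ Z ⁅ w ⁆ w) (cong₂ _xor_ w∉Z (lookup-⁅⁆-self w))

data PairSite : Bool → Bool → Bool → Set where
  at-u    : PairSite true  false true
  at-v    : PairSite false true  true
  in-V    : PairSite false false true
  outside : PairSite false false false

pairSite : ∀ {u v : Fin n} {V} → u ≢ v → u ∈ V → v ∈ V → ∀ i → PairSite (lookup ⁅ u ⁆ i) (lookup ⁅ v ⁆ i) (lookup V i)
pairSite {u = u} {v} {V} u≢v u∈V v∈V i with lookup ⁅ u ⁆ i in i≡u | lookup ⁅ v ⁆ i in i≡v | lookup V i in i∈V
... | true  | false | true  = at-u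
... | false | true  | true  = at-v
... | false | false | true  = in-V
... | false | false | false = outside
... | true  | true  | _     = ⊥-elim (u≢v (trans (sym (lookup-⁅⁆⇒≡ u i i≡u)) (lookup-⁅⁆⇒≡ v i i≡v)))
... | true  | false | false = ⊥-elim (not-¬ (⊆⇒lookup (⁅⁆⊆ u∈V) i i≡u) i∈V)
... | false | true  | false = ⊥-elim (not-¬ (⊆⇒lookup (⁅⁆⊆ v∈V) i i≡v) i∈V)

module SecondRecurrence
  (M : SetSystem n) (M-normal : Normal M) (vf : VfClosed M) (u v : Fin n)
  (u∈V : u ∈ ground M) (v∈V : v ∈ ground M) (uv∈M : (⁅ u ⁆ ∪ ⁅ v ⁆) ∈M M) (u∉M : ¬ (⁅ u ⁆ ∈M M))
  where

  open ≡-Reasoning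

  V : Subset n
  V = ground M

  N N′ : SetSystem n
  N = M *̄ V
  N′ = (N * ⁅ u ⁆) ∖w u

  u≢v : u ≢ v
  u≢v refl = u∉M (subst (_∈M M) (∪-idem ⁅ u ⁆) uv∈M)

  ⁅u⁆∉M : fam M ⁅ u ⁆ ≡ false
  ⁅u⁆∉M = ¬-not u∉M

  site : ∀ i → PairSite (lookup ⁅ u ⁆ i) (lookup ⁅ v ⁆ i) (lookup V i)
  site = pairSite u≢v u∈V v∈V

  N-ground : ground N ≡ V
  N-ground = DualPivots.forEach-ground M V

  N-exchange : Exchange N
  N-exchange = proj₂ (DualPivots.forEach-Δ M V vf ⊆-refl [] [])

  N′-exchange : Exchange N′
  N′-exchange = ∖w-exchange (N * ⁅ u ⁆) u (proj₂ (DualPivots.forEach-Δ M V vf ⊆-refl (piv u ∷ []) (u∈V ∷ [])))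

  M⟶N∖u : fam M ⟶[ onSet ⁅ u ⁆ deleteM ⊙ onSet V dualM ] fam (N ∖w u)
  M⟶N∖u = DualPivots.forEach⟶ M V ⨾ delete⟶ N ⁅ u ⁆

  M⟶N′ : fam M ⟶[ onSet ⁅ u ⁆ deleteM ⊙ (onSet ⁅ u ⁆ pivotM ⊙ onSet V dualM) ] fam N′
  M⟶N′ = DualPivots.forEach⟶ M V ⨾ pivot⟶ N ⁅ u ⁆ ⨾ delete⟶ (N * ⁅ u ⁆) ⁅ u ⁆

  M⟶N′∖v : fam M ⟶[ onSet ⁅ v ⁆ deleteM ⊙ (onSet ⁅ u ⁆ deleteM ⊙ (onSet ⁅ u ⁆ pivotM ⊙ onSet V dualM)) ] fam (N′ ∖w v)
  M⟶N′∖v = M⟶N′ ⨾ delete⟶ N′ ⁅ v ⁆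

  M⟶N′*v∖v : fam M ⟶[ onSet ⁅ v ⁆ deleteM ⊙ (onSet ⁅ v ⁆ pivotM ⊙ (onSet ⁅ u ⁆ deleteM ⊙ (onSet ⁅ u ⁆ pivotM ⊙ onSet V dualM))) ]
                fam ((N′ * ⁅ v ⁆) ∖w v)
  M⟶N′*v∖v = M⟶N′ ⨾ pivot⟶ N′ ⁅ v ⁆ ⨾ delete⟶ (N′ * ⁅ v ⁆) ⁅ v ⁆

  dual-delete-dual : ∀ {isU isV inV} → PairSite isU isV inV →
    when inV dualM · (when isU deleteM · when inV dualM) ≡ when isU sumM
  dual-delete-dual at-u    = refl
  dual-delete-dual at-v    = refl
  dual-delete-dual in-V    = refl
  dual-delete-dual outside = refl

  dual-N′∖v : ∀ {isU isV inV} → PairSite isU isV inV →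
    when inV dualM · (when isV deleteM · (when isU deleteM · (when isU pivotM · when inV dualM)))
      ≡ when isU shiftM · when isV sumM
  dual-N′∖v at-u    = refl
  dual-N′∖v at-v    = refl
  dual-N′∖v in-V    = refl
  dual-N′∖v outside = refl

  dual-N′*v∖v : ∀ {isU isV inV} → PairSite isU isV inV →
    when inV dualM · (when isV deleteM · (when isV pivotM · (when isU deleteM · (when isU pivotM · when inV dualM))))
      ≡ when isU shiftM · when isV shiftM
  dual-N′*v∖v at-u    = refl
  dual-N′*v∖v at-v    = refl
  dual-N′*v∖v in-V    = refl
  dual-N′*v∖v outside = refl

  N∖u-proper : Proper (N ∖w u)
  N∖u-proper = *̄-normal⇒proper (N ∖w u) V (begin
    fam ((N ∖w u) *̄ V) ⊥
      ≡⟨ (M⟶N∖u ⨾ DualPivots.forEach⟶ (N ∖w u) V) ⊥ ⟩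
    act (onSet V dualM ⊙ (onSet ⁅ u ⁆ deleteM ⊙ onSet V dualM)) (fam M) ⊥
      ≡⟨ act-cong (dual-delete-dual ∘ site) (λ _ → refl) ⊥ ⟩
    act (onSet ⁅ u ⁆ sumM) (fam M) ⊥
      ≡⟨ act-single-⊥ u sumM (fam M) ⟩
    fam M ⊥ xor fam M ⁅ u ⁆
      ≡⟨ cong₂ _xor_ M-normal ⁅u⁆∉M ⟩
    true ∎)

  N′∖v-proper : Proper (N′ ∖w v)
  N′∖v-proper = *̄-normal⇒proper (N′ ∖w v) V (begin
    fam ((N′ ∖w v) *̄ V) ⊥
      ≡⟨ (M⟶N′∖v ⨾ DualPivots.forEach⟶ (N′ ∖w v) V) ⊥ ⟩
    act (onSet V dualM ⊙ (onSet ⁅ v ⁆ deleteM ⊙ (onSet ⁅ u ⁆ deleteM ⊙ (onSet ⁅ u ⁆ pivotM ⊙ onSet V dualM)))) (fam M) ⊥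
      ≡⟨ act-cong (dual-N′∖v ∘ site) (λ _ → refl) ⊥ ⟩
    act (onSet ⁅ u ⁆ shiftM ⊙ onSet ⁅ v ⁆ sumM) (fam M) ⊥
      ≡⟨ act-pair-⊥ u v u≢v shiftM sumM (fam M) ⟩
    fam M ⁅ u ⁆ xor fam M (⁅ u ⁆ ∪ ⁅ v ⁆)
      ≡⟨ cong₂ _xor_ ⁅u⁆∉M uv∈M ⟩
    true ∎)

  N′*v∖v-proper : Proper ((N′ * ⁅ v ⁆) ∖w v)
  N′*v∖v-proper = *̄-normal⇒proper ((N′ * ⁅ v ⁆) ∖w v) V (begin
    fam (((N′ * ⁅ v ⁆) ∖w v) *̄ V) ⊥
      ≡⟨ (M⟶N′*v∖v ⨾ DualPivots.forEach⟶ ((N′ * ⁅ v ⁆) ∖w v) V) ⊥ ⟩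
    act (onSet V dualM ⊙ (onSet ⁅ v ⁆ deleteM ⊙ (onSet ⁅ v ⁆ pivotM ⊙ (onSet ⁅ u ⁆ deleteM ⊙ (onSet ⁅ u ⁆ pivotM ⊙ onSet V dualM)))))
        (fam M) ⊥
      ≡⟨ act-cong (dual-N′*v∖v ∘ site) (λ _ → refl) ⊥ ⟩
    act (onSet ⁅ u ⁆ shiftM ⊙ onSet ⁅ v ⁆ shiftM) (fam M) ⊥
      ≡⟨ act-pair-⊥ u v u≢v shiftM shiftM (fam M) ⟩
    fam M (⁅ u ⁆ ∪ ⁅ v ⁆)
      ≡⟨ uv∈M ⟩
    true ∎)

  second-split : ∀ k → q₁ N′ k ≡ q₁ (N′ ∖w v) k ℕ.+ q₁ ((N′ * ⁅ v ⁆) ∖w v) k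
  second-split with N′∖v-proper | N′*v∖v-proper
  ... | P′ , P′∈ | W , W∈ =
    let P′∈N′ , v∉P′ = ∖w-∈ N′ P′ v P′∈
        Q′∈N′ , v∈Q′ = pivot-∖w-∈ N′ v W W∈
        v∈ground-N′  = x∈p∧x≢y⇒x∈p-y (subst (v ∈_) (sym N-ground) v∈V) (u≢v ∘ sym)
    in q₁-split N′ v ⁅ v ⁆ N′-exchange P′∈N′ v∉P′ Q′∈N′ v∈Q′ (⁅⁆⊆ v∈ground-N′) (lookup-⁅⁆-self v)

  first-split : ∀ k → q₁ N k ≡ q₁ (N ∖w u) k ℕ.+ q₁ N′ k
  first-split with N∖u-proper | N′*v∖v-proper
  ... | P , P∈ | W , W∈ =
    let P∈N , u∉P = ∖w-∈ N P u P∈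
        Q′∈N′ , _ = pivot-∖w-∈ N′ v W W∈
        Q∈N , u∈Q = pivot-∖w-∈ N u _ Q′∈N′
    in q₁-split N u ⁅ u ⁆ N-exchange P∈N u∉P Q∈N u∈Q (⁅⁆⊆ (subst (u ∈_) (sym N-ground) u∈V)) (lookup-⁅⁆-self u)

  Cs-coordinate : ∀ {isU isV inV} → PairSite isU isV inV →
    when (if isU then false else inV) dualM · (when isU deleteM · when isU dualM) ≡ when isU deleteM · when inV dualM
  Cs-coordinate at-u    = refl
  Cs-coordinate at-v    = refl
  Cs-coordinate in-V    = refl
  Cs-coordinate outside = refl

  Bs-coordinate : ∀ {isU isV inV} → PairSite isU isV inV →
    when (if isU ∨ isV then false else inV) dualM · (when (isU ∨ isV) deleteM · (when isV dualM · when isU pivotM))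
      ≡ when isV deleteM · (when isU deleteM · (when isU pivotM · when inV dualM))
  Bs-coordinate at-u    = refl
  Bs-coordinate at-v    = refl
  Bs-coordinate in-V    = refl
  Bs-coordinate outside = refl

  As-coordinate : ∀ {isU isV inV} → PairSite isU isV inV →
    when (if isU ∨ isV then false else inV) dualM · (when (isU ∨ isV) deleteM · when (isU ∨ isV) pivotM)
      ≡ when isV deleteM · (when isV pivotM · (when isU deleteM · (when isU pivotM · when inV dualM)))
  As-coordinate at-u    = refl
  As-coordinate at-v    = refl
  As-coordinate in-V    = refl
  As-coordinate outside = refl

  Cs Bs As : SetSystem n
  Cs = (M *̄ ⁅ u ⁆) ∖w u
  Bs = ((M * ⁅ u ⁆) *̄ ⁅ v ⁆) ∖ (⁅ u ⁆ ∪ ⁅ v ⁆)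
  As = (M * (⁅ u ⁆ ∪ ⁅ v ⁆)) ∖ (⁅ u ⁆ ∪ ⁅ v ⁆)

  N′∖v-ground : ground (N′ ∖w v) ≡ V ─ (⁅ u ⁆ ∪ ⁅ v ⁆)
  N′∖v-ground = trans (p─q─r≡p─q∪r (ground N) ⁅ u ⁆ ⁅ v ⁆) (cong (_─ (⁅ u ⁆ ∪ ⁅ v ⁆)) N-ground)

  q₂-Cs : ∀ k → q₂ Cs k ≡ q₁ (N ∖w u) k
  q₂-Cs = q₁-cong (Cs *̄ ground Cs) (N ∖w u)
    (trans (DualPivots.forEach-ground Cs (ground Cs)) (trans Cs-ground (cong (_─ ⁅ u ⁆) (sym N-ground))))
    (⟶-unique (DualPivots.forEach⟶ M ⁅ u ⁆ ⨾ delete⟶ (M *̄ ⁅ u ⁆) ⁅ u ⁆ ⨾ DualPivots.forEach⟶ Cs (ground Cs)) M⟶N∖u coordinates)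
    where
    Cs-ground : ground Cs ≡ V ─ ⁅ u ⁆
    Cs-ground = cong (_─ ⁅ u ⁆) (DualPivots.forEach-ground M ⁅ u ⁆)
    coordinates : ∀ i → onSet (ground Cs) dualM i · (onSet ⁅ u ⁆ deleteM i · onSet ⁅ u ⁆ dualM i)
                      ≡ onSet ⁅ u ⁆ deleteM i · onSet V dualM i
    coordinates i rewrite Cs-ground | lookup-─ V ⁅ u ⁆ i = Cs-coordinate (site i)

  q₂-Bs : ∀ k → q₂ Bs k ≡ q₁ (N′ ∖w v) k
  q₂-Bs = q₁-cong (Bs *̄ ground Bs) (N′ ∖w v)
    (trans (DualPivots.forEach-ground Bs (ground Bs)) (trans Bs-ground (sym N′∖v-ground)))
    (⟶-unique (pivot⟶ M ⁅ u ⁆ ⨾ DualPivots.forEach⟶ (M * ⁅ u ⁆) ⁅ v ⁆ ⨾ delete⟶ ((M * ⁅ u ⁆) *̄ ⁅ v ⁆) (⁅ u ⁆ ∪ ⁅ v ⁆)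
                 ⨾ DualPivots.forEach⟶ Bs (ground Bs))
              M⟶N′∖v coordinates)
    where
    Bs-ground : ground Bs ≡ V ─ (⁅ u ⁆ ∪ ⁅ v ⁆)
    Bs-ground = cong (_─ (⁅ u ⁆ ∪ ⁅ v ⁆)) (DualPivots.forEach-ground (M * ⁅ u ⁆) ⁅ v ⁆)
    coordinates : ∀ i → onSet (ground Bs) dualM i · (onSet (⁅ u ⁆ ∪ ⁅ v ⁆) deleteM i · (onSet ⁅ v ⁆ dualM i · onSet ⁅ u ⁆ pivotM i))
                      ≡ onSet ⁅ v ⁆ deleteM i · (onSet ⁅ u ⁆ deleteM i · (onSet ⁅ u ⁆ pivotM i · onSet V dualM i))
    coordinates i rewrite Bs-ground | lookup-─ V (⁅ u ⁆ ∪ ⁅ v ⁆) i | lookup-∪ ⁅ u ⁆ ⁅ v ⁆ i = Bs-coordinate (site i)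

  q₂-As : ∀ k → q₂ As k ≡ q₁ ((N′ * ⁅ v ⁆) ∖w v) k
  q₂-As = q₁-cong (As *̄ ground As) ((N′ * ⁅ v ⁆) ∖w v)
    (trans (DualPivots.forEach-ground As (ground As)) (sym N′∖v-ground))
    (⟶-unique (pivot⟶ M (⁅ u ⁆ ∪ ⁅ v ⁆) ⨾ delete⟶ (M * (⁅ u ⁆ ∪ ⁅ v ⁆)) (⁅ u ⁆ ∪ ⁅ v ⁆)
                 ⨾ DualPivots.forEach⟶ As (ground As))
              M⟶N′*v∖v coordinates)
    where
    coordinates : ∀ i → onSet (ground As) dualM i · (onSet (⁅ u ⁆ ∪ ⁅ v ⁆) deleteM i · onSet (⁅ u ⁆ ∪ ⁅ v ⁆) pivotM i)
                      ≡ onSet ⁅ v ⁆ deleteM i · (onSet ⁅ v ⁆ pivotM i · (onSet ⁅ u ⁆ deleteM i · (onSet ⁅ u ⁆ pivotM i · onSet V dualM i)))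
    coordinates i rewrite lookup-─ V (⁅ u ⁆ ∪ ⁅ v ⁆) i | lookup-∪ ⁅ u ⁆ ⁅ v ⁆ i = As-coordinate (site i)

  recurrence : ∀ k → q₂ M k ≡ (q₂ As ⊞ (q₂ Bs ⊞ q₂ Cs)) k
  recurrence k = begin
    q₁ N k                                                               ≡⟨ first-split k ⟩
    q₁ (N ∖w u) k ℕ.+ q₁ N′ k                                            ≡⟨ cong (q₁ (N ∖w u) k ℕ.+_) (second-split k) ⟩
    q₁ (N ∖w u) k ℕ.+ (q₁ (N′ ∖w v) k ℕ.+ q₁ ((N′ * ⁅ v ⁆) ∖w v) k)   ≡⟨ reverse (q₁ (N ∖w u) k) (q₁ (N′ ∖w v) k) _ ⟩
    q₁ ((N′ * ⁅ v ⁆) ∖w v) k ℕ.+ (q₁ (N′ ∖w v) k ℕ.+ q₁ (N ∖w u) k)   ≡⟨ sym (cong₂ ℕ._+_ (q₂-As k) (cong₂ ℕ._+_ (q₂-Bs k) (q₂-Cs k))) ⟩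
    q₂ As k ℕ.+ (q₂ Bs k ℕ.+ q₂ Cs k)                                   ∎
    where
    reverse : ∀ x y z → x ℕ.+ (y ℕ.+ z) ≡ z ℕ.+ (y ℕ.+ x)
    reverse x y z = trans (+-comm x (y ℕ.+ z)) (trans (cong (ℕ._+ x) (+-comm y z)) (+-assoc z y x))

  As-normal : Normal As
  As-normal = ∖-normal (M * (⁅ u ⁆ ∪ ⁅ v ⁆)) (⁅ u ⁆ ∪ ⁅ v ⁆) (*-normal M uv∈M)

  Bs-normal : Normal Bs
  Bs-normal = ∖-normal ((M * ⁅ u ⁆) *̄ ⁅ v ⁆) (⁅ u ⁆ ∪ ⁅ v ⁆)
    (trans (*̄⁅⁆-⊥ (M * ⁅ u ⁆) v)
      (cong₂ _xor_ (trans (cong (fam M) (⊕-identityˡ ⁅ u ⁆)) ⁅u⁆∉M)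
                   (trans (cong (fam M) (trans (⊕-comm ⁅ v ⁆ ⁅ u ⁆) (sym (⁅⁆∪⁅⁆≡⁅⁆⊕⁅⁆ u v u≢v)))) uv∈M)))

  Cs-normal : Normal Cs
  Cs-normal = ∖-normal (M *̄ ⁅ u ⁆) ⁅ u ⁆ (trans (*̄⁅⁆-⊥ M u) (cong₂ _xor_ M-normal ⁅u⁆∉M))

data ChainSite : Bool → Bool → Bool → Set where
  at-u    : ChainSite true  true  true
  in-Y    : ChainSite false true  true
  in-V    : ChainSite false false true
  outside : ChainSite false false false

chainSite : ∀ {u : Fin n} {Y V} → u ∈ Y → Y ⊆ V → ∀ i → ChainSite (lookup ⁅ u ⁆ i) (lookup Y i) (lookup V i)
chainSite {u = u} {Y} {V} u∈Y Y⊆V i with lookup ⁅ u ⁆ i in i≡u | lookup Y i in i∈Y | lookup V i in i∈V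
... | true  | true  | true  = at-u
... | false | true  | true  = in-Y
... | false | false | true  = in-V
... | false | false | false = outside
... | true  | false | _     = ⊥-elim (not-¬ (⊆⇒lookup (⁅⁆⊆ u∈Y) i i≡u) i∈Y)
... | _     | true  | false = ⊥-elim (not-¬ (⊆⇒lookup Y⊆V i i∈Y) i∈V)

loop-delete : ∀ {isU inY inV} → ChainSite isU inY inV →
  when (if isU then false else inV) loopM · when isU deleteM ≡ when isU deleteM · when inV loopM
loop-delete at-u    = refl
loop-delete in-Y    = refl
loop-delete in-V    = refl
loop-delete outside = refl

loop-delete-dual : ∀ {isU inY inV} → ChainSite isU inY inV →
  when (if isU then false else inV) loopM · (when isU deleteM · when inY dualM)
    ≡ when isU deleteM · (when inY pivotM · when inV loopM)
loop-delete-dual at-u    = refl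
loop-delete-dual in-Y    = refl
loop-delete-dual in-V    = refl
loop-delete-dual outside = refl

q₃-recurrence : ∀ (M : SetSystem n) → WellFormed M → Normal M → VfClosed M → ∀ u →
  ∀ Y → Y ∈M (M + ground M) → u ∈ Y →
  (∀ k → q₃ M k ≡ (q₃ ((M *̄ Y) ∖w u) ⊞ q₃ (M ∖w u)) k) × Normal ((M *̄ Y) ∖w u) × Normal (M ∖w u)
q₃-recurrence {n} M M-wf M-normal vf u Y Y∈N u∈Y = recurrence , M*̄Y∖u-normal , ∖-normal M ⁅ u ⁆ M-normal
  where
  open ≡-Reasoning
  V : Subset n
  V = ground M
  N : SetSystem n
  N = M + V
  N-ground : ground N ≡ V
  N-ground = Loops.forEach-ground M V
  N-wf : WellFormed N
  N-wf = ⟶-wellFormed M N (onSet V loopM) N-ground M-wf (Loops.forEach⟶ M V) (λ i i∉V → cong (λ b → when b loopM) i∉V)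
  Y⊆V : Y ⊆ V
  Y⊆V = subst (Y ⊆_) N-ground (N-wf Y Y∈N)
  site : ∀ i → ChainSite (lookup ⁅ u ⁆ i) (lookup Y i) (lookup V i)
  site = chainSite u∈Y Y⊆V
  split : ∀ k → q₁ N k ≡ q₁ (N ∖w u) k ℕ.+ q₁ ((N * Y) ∖w u) k
  split = q₁-split N u Y (proj₂ (Loops.forEach-Δ M V vf ⊆-refl [] [])) (trans (+-⊥ M V) M-normal) (lookup-⊥ u)
                   Y∈N ([]=⇒lookup u∈Y) (N-wf Y Y∈N) ([]=⇒lookup u∈Y)
  M∖u≗N∖u : fam ((M ∖w u) + (V ─ ⁅ u ⁆)) ≗ fam (N ∖w u)
  M∖u≗N∖u = ⟶-unique (delete⟶ M ⁅ u ⁆ ⨾ Loops.forEach⟶ (M ∖w u) (V ─ ⁅ u ⁆)) (Loops.forEach⟶ M V ⨾ delete⟶ N ⁅ u ⁆)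
    λ i → trans (cong (λ b → when b loopM · _) (lookup-─ V ⁅ u ⁆ i)) (loop-delete (site i))
  V′ : Subset n
  V′ = ground (M *̄ Y) ─ ⁅ u ⁆
  lookup-V′ : ∀ i → lookup V′ i ≡ (if lookup ⁅ u ⁆ i then false else lookup V i)
  lookup-V′ i = trans (cong (λ W → lookup (W ─ ⁅ u ⁆) i) (DualPivots.forEach-ground M Y)) (lookup-─ V ⁅ u ⁆ i)
  M*̄Y∖u≗N*Y∖u : fam (((M *̄ Y) ∖w u) + V′) ≗ fam ((N * Y) ∖w u)
  M*̄Y∖u≗N*Y∖u =
    ⟶-unique (DualPivots.forEach⟶ M Y ⨾ delete⟶ (M *̄ Y) ⁅ u ⁆ ⨾ Loops.forEach⟶ ((M *̄ Y) ∖w u) V′)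
             (Loops.forEach⟶ M V ⨾ pivot⟶ N Y ⨾ delete⟶ (N * Y) ⁅ u ⁆)
    λ i → trans (cong (λ b → when b loopM · _) (lookup-V′ i))
                (loop-delete-dual (site i))
  q₃-M∖u : ∀ k → q₃ (M ∖w u) k ≡ q₁ (N ∖w u) k
  q₃-M∖u = q₁-cong _ _ (trans (Loops.forEach-ground (M ∖w u) (V ─ ⁅ u ⁆)) (cong (_─ ⁅ u ⁆) (sym N-ground))) M∖u≗N∖u
  q₃-M*̄Y∖u : ∀ k → q₃ ((M *̄ Y) ∖w u) k ≡ q₁ ((N * Y) ∖w u) k
  q₃-M*̄Y∖u = q₁-cong _ _ (trans (Loops.forEach-ground _ V′) (trans (cong (_─ ⁅ u ⁆) (DualPivots.forEach-ground M Y))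
                                                                     (cong (_─ ⁅ u ⁆) (sym N-ground))))
                         M*̄Y∖u≗N*Y∖u
  recurrence : ∀ k → q₁ N k ≡ q₃ ((M *̄ Y) ∖w u) k ℕ.+ q₃ (M ∖w u) k
  recurrence k = begin
    q₁ N k                                           ≡⟨ split k ⟩
    q₁ (N ∖w u) k ℕ.+ q₁ ((N * Y) ∖w u) k             ≡⟨ +-comm (q₁ (N ∖w u) k) _ ⟩
    q₁ ((N * Y) ∖w u) k ℕ.+ q₁ (N ∖w u) k             ≡⟨ sym (cong₂ ℕ._+_ (q₃-M*̄Y∖u k) (q₃-M∖u k)) ⟩
    q₃ ((M *̄ Y) ∖w u) k ℕ.+ q₃ (M ∖w u) k             ∎
  M*̄Y∖u-normal : Normal ((M *̄ Y) ∖w u)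
  M*̄Y∖u-normal = trans (sym (+-⊥ ((M *̄ Y) ∖w u) V′))
                          (trans (M*̄Y∖u≗N*Y∖u ⊥) (∖-normal (N * Y) ⁅ u ⁆ (*-normal N Y∈N)))

corollary19 : ∀ {n} (M : SetSystem n) → WellFormed M → Normal M → VfClosed M →
    ∀ (u : Fin n) → u ∈ ground M →
    (∀ (X : Subset n) → X ∈M M → u ∈ X →
       (∀ k → q₁ M k ≡ (q₁ (M ∖w u) ⊞ q₁ ((M * X) ∖w u)) k)
       × Normal (M ∖w u) × Normal ((M * X) ∖w u))
    ×
    (∀ (v : Fin n) → v ∈ ground M → (⁅ u ⁆ ∪ ⁅ v ⁆) ∈M M →
       ¬ (⁅ u ⁆ ∈M M) → ¬ (⁅ v ⁆ ∈M M) →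
       (∀ k → q₂ M k ≡
          (q₂ ((M * (⁅ u ⁆ ∪ ⁅ v ⁆)) ∖ (⁅ u ⁆ ∪ ⁅ v ⁆))
           ⊞ (q₂ (((M * ⁅ u ⁆) *̄ ⁅ v ⁆) ∖ (⁅ u ⁆ ∪ ⁅ v ⁆))
           ⊞ q₂ ((M *̄ ⁅ u ⁆) ∖w u))) k)
       × Normal ((M * (⁅ u ⁆ ∪ ⁅ v ⁆)) ∖ (⁅ u ⁆ ∪ ⁅ v ⁆))
       × Normal (((M * ⁅ u ⁆) *̄ ⁅ v ⁆) ∖ (⁅ u ⁆ ∪ ⁅ v ⁆))
       × Normal ((M *̄ ⁅ u ⁆) ∖w u))
    ×
    (∀ (Y : Subset n) → Y ∈M (M + ground M) → u ∈ Y →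
       (∀ k → q₃ M k ≡ (q₃ ((M *̄ Y) ∖w u) ⊞ q₃ (M ∖w u)) k)
       × Normal ((M *̄ Y) ∖w u) × Normal (M ∖w u))
corollary19 M M-wf M-normal vf u u∈V =
  q₁-recurrence M M-wf M-normal vf u ,
  (λ v v∈V uv∈M u∉M _ →
     let open SecondRecurrence M M-normal vf u v u∈V v∈V uv∈M u∉M
     in recurrence , As-normal , Bs-normal , Cs-normal) ,
  q₃-recurrence M M-wf M-normal vf u
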